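{- Let $q$ be a prime power, $n\ge 2$, $m=n-1$, and for $i=1,2$ let $C_i\le\mathbb{F}_q^{n\times(n-1)}$ be an $\mathbb{F}_q$-linear MRD code of $\mathbb{F}_q$-dimension $k_i$ and minimum rank distance $d_i$, and let $\mathcal{M}_i=\mathcal{M}[C_i]$. Assume $1<k_1<k_2$ and $k_1+k_2\ge n$. Let $\lambda=\frac{a}{b}$ with $a,b\in\mathbb{N}$, $\gcd(a,b)=1$, $0<\lambda<1$, and let $\mathcal{M}=(1-\lambda)\mathcal{M}_1+\lambda\mathcal{M}_2$. Then $\mu=b(n-1)$ is a denominator for $\mathcal{M}$ and $\mathcal{I}_\mu(\mathcal{M})=\mathcal{L}(E)$, where $E=\mathbb{F}_q^n$.
   Context: An $\mathbb{F}_q$-linear rank-metric code $C\le\mathbb{F}_q^{n\times m}$ is an $\mathbb{F}_q$-subspace; its minimum distance is $d=\min\{\mathrm{rk}(M):0\ne M\in C\}$; it is MRD if $\dim_{\mathbb{F}_q}C=\max\{n,m\}(\min\{n,m\}-d+1)$. For $U\le\mathbb{F}_q^n$ let $C(U)=\{M\in C:\mathrm{colsp}(M)\le U^\perp\}$ ($U^\perp$ the orthogonal complement w.r.t. the standard dot product), and define $\rho(U)=(\dim_{\mathbb{F}_q}C-\dim_{\mathbb{F}_q}C(U))/m$; then $\mathcal{M}[C]=(\mathcal{L}(\mathbb{F}_q^n),\rho)$ is a $q$-polymatroid. (For an MRD code in $\mathbb{F}_q^{n\times(n-1)}$ of dimension $k$, one has $\rho(U)=\dim U$ if $\dim U\le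 k/n$ and $\rho(U)=k/(n-1)$ if $\dim U>k/n$.) $(1-\lambda)\mathcal{M}_1+\lambda\mathcal{M}_2$ has rank function $(1-\lambda)\rho_1+\lambda\rho_2$. A denominator is $\mu>0$ with $\mu\rho(X)\in\mathbb{Z}_{\ge0}$ for all $X$; a space $I$ is $\mu$-independent if $\rho(J)\ge\dim(J)/\mu$ for all $J\le I$, and $\mathcal{I}_\mu(\mathcal{M})$ is the set of $\mu$-independent spaces. -}

module Defs where

open import Level using (0ℓ)
open import Data.Bool.ListAction using (all; any)
open import Data.Bool using (Bool; true; false; _∧_; _∨_; not; if_then_else_)
open import Data.Nat as ℕ using (ℕ; zero; suc; _^_; _≡ᵇ_; _∸_; _⊔_; _⊓_)
open import Data.Integer as ℤ using (ℤ; +_)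
open import Data.Rational as ℚ using (ℚ; 0ℚ)
open import Data.Fin using (Fin)
open import Data.Vec as Vec using (Vec; []; _∷_; zipWith; lookup)
open import Data.Vec.Properties using (≡-dec)
open import Data.List as List using (List; []; _∷_; length; filterᵇ; concatMap; allFin)
open import Data.List.Membership.Propositional using (_∈_)
open import Data.List.Relation.Unary.Unique.Propositional using (Unique)
open import Data.Product using (∃; _×_)
open import Relation.Nullary using (¬_; does)
open import Relation.Binary.PropositionalEquality using (_≡_; _≢_)
open import Relation.Binary.Definitions using (DecidableEquality)
open import Algebra.Structures using (IsCommutativeRing)

-- Finite fields (q = number of elements; q is then automatically a
-- prime power).

record FiniteField : Set₁ where
  infixl 6 _+_
  infixl 7 _*_
  field
    Carrier    : Set
    _+_ _*_    : Carrier → Carrier → Carrier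
    -_         : Carrier → Carrier
    0# 1#      : Carrier
    isCommutativeRing : IsCommutativeRing _≡_ _+_ _*_ -_ 0# 1#
    0≢1        : 0# ≢ 1#
    inverse    : ∀ x → x ≢ 0# → ∃ λ y → x * y ≡ 1#
    _≟_        : DecidableEquality Carrier
    elements   : List Carrier
    complete   : ∀ x → x ∈ elements
    unique     : Unique elements

  q : ℕ
  q = length elements

allVecsOf : {A : Set} → List A → (n : ℕ) → List (Vec A n)
allVecsOf xs zero    = [] ∷ []
allVecsOf xs (suc n) = concatMap (λ x → List.map (x ∷_) (allVecsOf xs n)) xs

count : {A : Set} → (A → Bool) → List A → ℕ
count p xs = length (filterᵇ p xs)

-- logq b c = the (least) k with b ^ k ≡ c (0 if there is none);
-- used to turn a cardinality q^k into the dimension k.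
logq : ℕ → ℕ → ℕ
logq b c = go c 0
  where
  go : ℕ → ℕ → ℕ
  go zero k       = k
  go (suc fuel) k = if b ^ k ≡ᵇ c then k else go fuel (suc k)

-- division of an integer by a natural number, as a rational
-- (only ever used with a nonzero divisor)
divℕ : ℤ → ℕ → ℚ
divℕ z zero    = 0ℚ
divℕ z (suc d) = z ℚ./ suc d

record FinVS (F : FiniteField) : Set₁ where
  open FiniteField F
  field
    V      : Set
    zeroV  : V
    _⊕_    : V → V → V
    _⊙_    : Carrier → V → V
    allV   : List V

record Subspace {F : FiniteField} (W : FinVS F) : Set where
  open FiniteField F
  open FinVS W
  field
    mem      : V → Bool
    mem-zero : mem zeroV ≡ true
    mem-add  : ∀ u v → mem u ≡ true → mem v ≡ true → mem (u ⊕ v) ≡ true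
    mem-smul : ∀ c v → mem v ≡ true → mem (c ⊙ v) ≡ true
open Subspace public

dimOf : {F : FiniteField} (W : FinVS F) → (FinVS.V W → Bool) → ℕ
dimOf {F} W p = logq (FiniteField.q F) (count p (FinVS.allV W))

dim : {F : FiniteField} {W : FinVS F} → Subspace W → ℕ
dim {W = W} S = dimOf W (mem S)

module _ (F : FiniteField) where
  open FiniteField F

  Vect : ℕ → Set
  Vect n = Vec Carrier n

  Mat : ℕ → ℕ → Set
  Mat n m = Vec (Vec Carrier m) n

  allVects : (n : ℕ) → List (Vect n)
  allVects n = allVecsOf elements n

  allMats : (n m : ℕ) → List (Mat n m)
  allMats n m = allVecsOf (allVects m) n

  dot : {n : ℕ} → Vect n → Vect n → Carrier
  dot u v = Vec.foldr _ _+_ 0# (zipWith _*_ u v)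

  VecSpace : ℕ → FinVS F
  VecSpace n = record
    { V = Vect n ; zeroV = Vec.replicate n 0# ; _⊕_ = zipWith _+_
    ; _⊙_ = λ c → Vec.map (c *_) ; allV = allVects n }

  MatSpace : ℕ → ℕ → FinVS F
  MatSpace n m = record
    { V = Mat n m ; zeroV = Vec.replicate n (Vec.replicate m 0#)
    ; _⊕_ = zipWith (zipWith _+_)
    ; _⊙_ = λ c → Vec.map (Vec.map (c *_)) ; allV = allMats n m }

  zeroMat : (n m : ℕ) → Mat n m
  zeroMat n m = FinVS.zeroV (MatSpace n m)

  _≟V_ : {n : ℕ} → DecidableEquality (Vect n)
  _≟V_ = ≡-dec _≟_

  col : {n m : ℕ} → Mat n m → Fin m → Vect n
  col M j = Vec.map (λ row → lookup row j) M

  mulVec : {n m : ℕ} → Mat n m → Vect m → Vect n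
  mulVec M x = Vec.map (λ row → dot row x) M

  inColsp : {n m : ℕ} → Mat n m → Vect n → Bool
  inColsp {n} {m} M v = any (λ x → does (mulVec M x ≟V v)) (allVects m)

  rk : {n m : ℕ} → Mat n m → ℕ
  rk {n} M = logq q (count (inColsp M) (allVects n))

  Code : ℕ → ℕ → Set
  Code n m = Subspace (MatSpace n m)

  IsMinDist : {n m : ℕ} → Code n m → ℕ → Set
  IsMinDist {n} {m} C d =
    (∃ λ M → mem C M ≡ true × M ≢ zeroMat n m × rk M ≡ d) ×
    (∀ M → mem C M ≡ true → M ≢ zeroMat n m → d ℕ.≤ rk M)

  IsMRD : {n m : ℕ} → Code n m → ℕ → Set
  IsMRD {n} {m} C d = dim C ≡ (n ⊔ m) ℕ.* ((n ⊓ m) ∸ d ℕ.+ 1)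

  inPerp : {n : ℕ} → Subspace (VecSpace n) → Vect n → Bool
  inPerp {n} U v = all (λ u → not (mem U u) ∨ does (dot u v ≟ 0#)) (allVects n)

  -- C(U) = { M ∈ C : colsp(M) ≤ U^⊥ }, as a membership predicate
  -- (colsp(M) ≤ U^⊥ iff every column of M lies in the subspace U^⊥)
  inShortened : {n m : ℕ} → Code n m → Subspace (VecSpace n) → Mat n m → Bool
  inShortened {n} {m} C U M = mem C M ∧ all (λ j → inPerp U (col M j)) (allFin m)

  ρ[_] : {n m : ℕ} → Code n m → Subspace (VecSpace n) → ℚ
  ρ[_] {n} {m} C U =
    divℕ (+ dim C ℤ.- + dimOf (MatSpace n m) (inShortened C U)) m

  RankFn : ℕ → Set
  RankFn n = Subspace (VecSpace n) → ℚ

  mix : {n : ℕ} → ℚ → RankFn n → RankFn n → RankFn n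
  mix λ' ρ₁ ρ₂ U = (ℚ.1ℚ ℚ.- λ') ℚ.* ρ₁ U ℚ.+ λ' ℚ.* ρ₂ U

  IsDenominator : {n : ℕ} → RankFn n → ℕ → Set
  IsDenominator {n} ρ μ =
    0 ℕ.< μ × (∀ (X : Subspace (VecSpace n)) → ∃ λ (k : ℕ) → divℕ (+ μ) 1 ℚ.* ρ X ≡ divℕ (+ k) 1)

  _≤ₛ_ : {n : ℕ} → Subspace (VecSpace n) → Subspace (VecSpace n) → Set
  J ≤ₛ I = ∀ v → mem J v ≡ true → mem I v ≡ true

  IsIndep : {n : ℕ} → RankFn n → ℕ → Subspace (VecSpace n) → Set
  IsIndep {n} ρ μ I = ∀ (J : Subspace (VecSpace n)) → J ≤ₛ I → divℕ (+ dim J) μ ℚ.≤ ρ J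

-- Let C ≤ F^{n×m} (m ≤ n) be MRD with minimum distance d and t = m − d + 1, so dim C = n t.
-- A codeword vanishing on its first t columns has rank at most m − t < d, hence is 0; so a
-- codeword is determined by its first t columns. For M ∈ C(X) these columns lie in X^⊥, and
-- dim X^⊥ = n − dim X, so dim C(X) ≤ (n − dim X) t and dim X ≤ dim C − dim C(X) = m ρ(X).
-- With λ = a/b and c = b − a the mixture is (c e₁(X) + a e₂(X)) / (b m), eᵢ = m ρᵢ ∈ ℕ,
-- so b m is a denominator, and e₁, e₂ ≥ dim X makes every space μ-independent. Dimensions are read off cardinalities:
-- every subspace of F^N has q^k elements, and |X| |X^⊥| = q^N.

module Submission where

open import Defs
open import Algebra.Bundles using (CommutativeRing)
import Algebra.Properties.CommutativeSemigroup as CommutativeSemigroupProperties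
import Algebra.Properties.Ring as RingProperties
open import Data.Bool using (Bool; true; false; T; T?; not; _∧_; _∨_; if_then_else_)
open import Data.Bool.ListAction using (all; any)
import Data.Bool.Properties as Boolₚ
open import Data.Empty using (⊥; ⊥-elim)
open import Data.Fin using (Fin; toℕ; inject≤; fromℕ<) renaming (zero to fzero; suc to fsuc)
import Data.Fin.Properties as Finₚ
open import Data.Integer as ℤ using (+_)
import Data.Integer.Properties as ℤₚ
open import Data.Integer.Tactic.RingSolver using (solve-∀)
open import Data.List using (List; []; _∷_; length; filterᵇ; concatMap; map; _++_; allFin)
open import Data.List.Membership.Propositional using (_∈_)
open import Data.List.Membership.Propositional.Properties
  using (∈-∃++; ∈-++⁺ˡ; ∈-++⁺ʳ; ∈-++⁻; ∈-map⁺; ∈-map⁻; ∈-concatMap⁺; ∈-concatMap⁻;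
         ∈-filter⁺; ∈-filter⁻; ∈-allFin)
import Data.List.Properties as Listₚ
open import Data.List.Relation.Unary.All as All using (All; []; _∷_)
open import Data.List.Relation.Unary.AllPairs using ([]; _∷_)
open import Data.List.Relation.Unary.Any as Any using (Any; here; there)
open import Data.List.Relation.Unary.Unique.Propositional using (Unique)
open import Data.List.Relation.Unary.Unique.Propositional.Properties using (filter⁺; ++⁺)
open import Data.Nat as ℕ using (ℕ; zero; suc; _+_; _*_; _∸_; _^_; _≤_; _<_; z≤n; s≤s; _≡ᵇ_)
open import Data.Nat.GCD using (gcd)
open import Data.Nat.ListAction using (sum)
import Data.Nat.Properties as ℕₚ
open import Data.Product using (∃; _×_; _,_; proj₁; proj₂)
open import Data.Rational as ℚ using (0ℚ; 1ℚ; toℚᵘ) renaming (_<_ to _<ℚ_)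
import Data.Rational.Properties as ℚₚ
open import Data.Rational.Unnormalised as ℚᵘ using (mkℚᵘ; *≡*; *≤*; *<*)
import Data.Rational.Unnormalised.Properties as ℚᵘₚ
open import Data.Sum using (_⊎_; inj₁; inj₂)
open import Data.Vec as Vec using (Vec; []; _∷_; zipWith; replicate; lookup; tabulate)
import Data.Vec.Properties as Vecₚ
open import Function.Bundles using (mk⇔)
open import Level using (0ℓ)
open import Relation.Binary.PropositionalEquality
open import Relation.Nullary using (Dec; yes; no; does; ¬?; _×-dec_)
open import Relation.Nullary.Decidable using (dec-true)

private variable
  A B : Set

open CommutativeSemigroupProperties ℕₚ.*-commutativeSemigroup using () renaming (x∙yz≈y∙xz to x*[y*z]≡y*[x*z])

count-++ : (p : A → Bool) (xs ys : List A) → count p (xs ++ ys) ≡ count p xs + count p ys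
count-++ p []       ys = refl
count-++ p (x ∷ xs) ys with p x
... | true  = cong suc (count-++ p xs ys)
... | false = count-++ p xs ys

count-map : (p : B → Bool) (f : A → B) (xs : List A) → count p (map f xs) ≡ count (λ x → p (f x)) xs
count-map p f []       = refl
count-map p f (x ∷ xs) with p (f x)
... | true  = cong suc (count-map p f xs)
... | false = count-map p f xs

count-concatMap : (p : B → Bool) (f : A → List B) (xs : List A) →
                  count p (concatMap f xs) ≡ sum (map (λ x → count p (f x)) xs)
count-concatMap p f []       = refl
count-concatMap p f (x ∷ xs) =
  trans (count-++ p (f x) (concatMap f xs)) (cong (_+_ (count p (f x))) (count-concatMap p f xs))

count≤length : (p : A → Bool) (xs : List A) → count p xs ≤ length xs
count≤length p = Listₚ.length-filter (λ x → T? (p x))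

count-cong : {p p′ : A → Bool} → (∀ x → p x ≡ p′ x) → (xs : List A) → count p xs ≡ count p′ xs
count-cong p≗p′ []       = refl
count-cong {p = p} {p′} p≗p′ (x ∷ xs) with p x | p′ x | p≗p′ x
... | true  | .true  | refl = cong suc (count-cong p≗p′ xs)
... | false | .false | refl = count-cong p≗p′ xs

count-all : (p : A → Bool) (xs : List A) → (∀ x → p x ≡ true) → count p xs ≡ length xs
count-all p []       all-p = refl
count-all p (x ∷ xs) all-p rewrite all-p x = cong suc (count-all p xs all-p)

count-none : (p : A → Bool) (xs : List A) → (∀ {x} → x ∈ xs → p x ≡ true → ⊥) → count p xs ≡ 0
count-none p []       none-p = refl
count-none p (x ∷ xs) none-p with p x in px
... | true  = ⊥-elim (none-p (here refl) px)
... | false = count-none p xs (λ x∈xs → none-p (there x∈xs))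

sum-map-indicator : (g : A → ℕ) (r : A → Bool) (K : ℕ) (xs : List A) →
                    (∀ x → g x ≡ (if r x then K else 0)) → sum (map g xs) ≡ count r xs * K
sum-map-indicator g r K []       g≡ = refl
sum-map-indicator g r K (x ∷ xs) g≡ with r x | g≡ x
... | true  | gx≡K = cong₂ _+_ gx≡K (sum-map-indicator g r K xs g≡)
... | false | gx≡0 = cong₂ _+_ gx≡0 (sum-map-indicator g r K xs g≡)

∈-filterᵇ⁻ : (p : A → Bool) {x : A} {xs : List A} → x ∈ filterᵇ p xs → x ∈ xs × p x ≡ true
∈-filterᵇ⁻ p {x} {xs} x∈ with ∈-filter⁻ (λ y → T? (p y)) {xs = xs} x∈
... | x∈xs , _ with p x
...   | true = x∈xs , refl

∈-filterᵇ⁺ : (p : A → Bool) {x : A} {xs : List A} → x ∈ xs → p x ≡ true → x ∈ filterᵇ p xs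
∈-filterᵇ⁺ p x∈xs px = ∈-filter⁺ (λ y → T? (p y)) x∈xs (subst T (sym px) _)

filterᵇ-unique : (p : A → Bool) {xs : List A} → Unique xs → Unique (filterᵇ p xs)
filterᵇ-unique p = filter⁺ (λ x → T? (p x))

unique-⊆⇒length-≤ : {xs ys : List A} → Unique xs → (∀ {x} → x ∈ xs → x ∈ ys) → length xs ≤ length ys
unique-⊆⇒length-≤ {xs = []}     _            _  = z≤n
unique-⊆⇒length-≤ {xs = x ∷ xs} (x∉xs ∷ !xs) xs⊆ys with ∈-∃++ (xs⊆ys (here refl))
... | us , vs , refl = begin
  suc (length xs)             ≤⟨ s≤s (unique-⊆⇒length-≤ !xs xs⊆us++vs) ⟩
  suc (length (us ++ vs))     ≡⟨ cong suc (Listₚ.length-++ us) ⟩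
  suc (length us + length vs) ≡⟨ ℕₚ.+-suc (length us) (length vs) ⟨
  length us + length (x ∷ vs) ≡⟨ Listₚ.length-++ us ⟨
  length (us ++ x ∷ vs)       ∎
  where
  open ℕₚ.≤-Reasoning
  xs⊆us++vs : ∀ {y} → y ∈ xs → y ∈ us ++ vs
  xs⊆us++vs {y} y∈xs with ∈-++⁻ us (xs⊆ys (there y∈xs))
  ... | inj₁ y∈us        = ∈-++⁺ˡ y∈us
  ... | inj₂ (here refl) = ⊥-elim (All.lookup x∉xs y∈xs refl)
  ... | inj₂ (there y∈vs) = ∈-++⁺ʳ us y∈vs

map-unique : (f : A → B) {xs : List A} → Unique xs →
             (∀ {x y} → x ∈ xs → y ∈ xs → f x ≡ f y → x ≡ y) → Unique (map f xs)
map-unique f {[]}     []           _   = []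
map-unique f {x ∷ xs} (x∉xs ∷ !xs) inj =
  All.tabulate fx∉ ∷ map-unique f !xs (λ x∈ y∈ → inj (there x∈) (there y∈))
  where
  fx∉ : ∀ {z} → z ∈ map f xs → f x ≢ z
  fx∉ z∈ fx≡z with ∈-map⁻ f z∈
  ... | y , y∈xs , refl = All.lookup x∉xs y∈xs (inj (here refl) (there y∈xs) fx≡z)

count-≤-injection : (p : A → Bool) (p′ : B → Bool) (f : A → B) {xs : List A} {ys : List B} →
  Unique xs → (∀ y → y ∈ ys) →
  (∀ x → p x ≡ true → p′ (f x) ≡ true) →
  (∀ x x′ → p x ≡ true → p x′ ≡ true → f x ≡ f x′ → x ≡ x′) →
  count p xs ≤ count p′ ys
count-≤-injection p p′ f {xs} {ys} !xs ys-complete f-maps f-inj = begin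
  count p xs                       ≡⟨ Listₚ.length-map f (filterᵇ p xs) ⟨
  length (map f (filterᵇ p xs))    ≤⟨ unique-⊆⇒length-≤ !image image⊆ ⟩
  count p′ ys                      ∎
  where
  open ℕₚ.≤-Reasoning
  !image : Unique (map f (filterᵇ p xs))
  !image = map-unique f (filterᵇ-unique p !xs)
    (λ x∈ x′∈ → f-inj _ _ (proj₂ (∈-filterᵇ⁻ p {xs = xs} x∈)) (proj₂ (∈-filterᵇ⁻ p {xs = xs} x′∈)))
  image⊆ : ∀ {y} → y ∈ map f (filterᵇ p xs) → y ∈ filterᵇ p′ ys
  image⊆ y∈ with ∈-map⁻ f y∈
  ... | x , x∈ , refl = ∈-filterᵇ⁺ p′ (ys-complete (f x)) (f-maps x (proj₂ (∈-filterᵇ⁻ p {xs = xs} x∈)))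

count-≡-bijection : (p : A → Bool) (p′ : B → Bool) (f : A → B) (g : B → A) {xs : List A} {ys : List B} →
  Unique xs → (∀ x → x ∈ xs) → Unique ys → (∀ y → y ∈ ys) →
  (∀ x → p x ≡ true → p′ (f x) ≡ true) →
  (∀ y → p′ y ≡ true → p (g y) ≡ true) →
  (∀ x → p x ≡ true → g (f x) ≡ x) →
  (∀ y → p′ y ≡ true → f (g y) ≡ y) →
  count p xs ≡ count p′ ys
count-≡-bijection p p′ f g !xs xs-complete !ys ys-complete f-maps g-maps gf≡id fg≡id = ℕₚ.≤-antisym
  (count-≤-injection p p′ f !xs ys-complete f-maps
    (λ x x′ px px′ fx≡fx′ → trans (sym (gf≡id x px)) (trans (cong g fx≡fx′) (gf≡id x′ px′))))
  (count-≤-injection p′ p g !ys xs-complete g-maps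
    (λ y y′ py py′ gy≡gy′ → trans (sym (fg≡id y py)) (trans (cong f gy≡gy′) (fg≡id y′ py′))))

all≡true⁻ : (p : A → Bool) (xs : List A) → all p xs ≡ true → ∀ {x} → x ∈ xs → p x ≡ true
all≡true⁻ p (x ∷ xs) all≡ x∈ with p x in px | x∈
... | true | here refl  = px
... | true | there x∈xs = all≡true⁻ p xs all≡ x∈xs

all≡true⁺ : (p : A → Bool) (xs : List A) → (∀ {x} → x ∈ xs → p x ≡ true) → all p xs ≡ true
all≡true⁺ p []       _     = refl
all≡true⁺ p (x ∷ xs) all-p rewrite all-p (here refl) = all≡true⁺ p xs (λ x∈ → all-p (there x∈))

any≡true⁻ : (p : A → Bool) (xs : List A) → any p xs ≡ true → ∃ λ x → x ∈ xs × p x ≡ true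
any≡true⁻ p (x ∷ xs) any≡ with p x in px
... | true  = x , here refl , px
... | false with any≡true⁻ p xs any≡
...   | y , y∈xs , py = y , there y∈xs , py

any≡true⁺ : (p : A → Bool) (xs : List A) {x : A} → x ∈ xs → p x ≡ true → any p xs ≡ true
any≡true⁺ p (x ∷ xs) (here refl)  px rewrite px = refl
any≡true⁺ p (y ∷ xs) (there x∈xs) px with p y
... | true  = refl
... | false = any≡true⁺ p xs x∈xs px

false≢true : false ≢ true
false≢true ()

dec-true⁻ : {P : Set} (P? : Dec P) → does P? ≡ true → P
dec-true⁻ (yes p) _ = p

∧≡true⁻ : {a b : Bool} → (a ∧ b) ≡ true → a ≡ true × b ≡ true
∧≡true⁻ {true} {true} _ = refl , refl

∧≡true⁺ : {a b : Bool} → a ≡ true → b ≡ true → (a ∧ b) ≡ true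
∧≡true⁺ refl refl = refl


∈-allVecsOf : {xs : List A} → (∀ x → x ∈ xs) → (n : ℕ) (v : Vec A n) → v ∈ allVecsOf xs n
∈-allVecsOf complete zero    []      = here refl
∈-allVecsOf {xs = xs} complete (suc n) (x ∷ v) =
  ∈-concatMap⁺ (λ y → map (y ∷_) (allVecsOf xs n)) {xs = xs}
    (Any.map (λ { refl → ∈-map⁺ (x ∷_) (∈-allVecsOf complete n v) }) (complete x))

allVecsOf-unique : {xs : List A} → Unique xs → (n : ℕ) → Unique (allVecsOf xs n)
allVecsOf-unique !xs zero = [] ∷ []
allVecsOf-unique {A = A} {xs} !xs (suc n) = go !xs
  where
  vs = allVecsOf xs n
  prefixed : A → List (Vec A (suc n))
  prefixed y = map (y ∷_) vs
  go : {ys : List A} → Unique ys → Unique (concatMap prefixed ys)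
  go {[]}     _            = []
  go {y ∷ ys} (y∉ys ∷ !ys) =
    ++⁺ (map-unique (y ∷_) (allVecsOf-unique !xs n) (λ _ _ → cong Vec.tail)) (go !ys) disjoint
    where
    disjoint : ∀ {v} → v ∈ prefixed y × v ∈ concatMap prefixed ys → ⊥
    disjoint (v∈ , v∈′) with ∈-map⁻ (y ∷_) v∈
    ... | w , _ , refl = All.lookup y∉ys (head∈ (∈-concatMap⁻ prefixed {xs = ys} v∈′)) refl
      where
      head∈ : ∀ {zs} → Any (λ z → (y ∷ w) ∈ prefixed z) zs → y ∈ zs
      head∈ (here y∷w∈) with ∈-map⁻ (_ ∷_) y∷w∈
      ... | _ , _ , refl = here refl
      head∈ (there any) = there (head∈ any)

count-allVecsOf-suc : {n : ℕ} (p : Vec A (suc n) → Bool) (xs : List A) →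
  count p (allVecsOf xs (suc n)) ≡ sum (map (λ x → count (λ v → p (x ∷ v)) (allVecsOf xs n)) xs)
count-allVecsOf-suc {n = n} p xs = trans
  (count-concatMap p (λ x → map (x ∷_) (allVecsOf xs n)) xs)
  (cong sum (Listₚ.map-cong (λ x → count-map p (x ∷_) (allVecsOf xs n)) xs))

allᵛ : {t : ℕ} → (A → Bool) → Vec A t → Bool
allᵛ P []      = true
allᵛ P (x ∷ v) = P x ∧ allᵛ P v

allᵛ-tabulate : ∀ {k} (P : A → Bool) (f : Fin k → A) → (∀ i → P (f i) ≡ true) → allᵛ P (tabulate f) ≡ true
allᵛ-tabulate {k = zero}  P f Pf = refl
allᵛ-tabulate {k = suc k} P f Pf = ∧≡true⁺ (Pf fzero) (allᵛ-tabulate P (λ i → f (fsuc i)) (λ i → Pf (fsuc i)))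

count-allᵛ : (P : A → Bool) (xs : List A) (t : ℕ) → count (allᵛ P) (allVecsOf xs t) ≡ count P xs ^ t
count-allᵛ P xs zero    = refl
count-allᵛ P xs (suc t) = begin
  count (allᵛ P) (allVecsOf xs (suc t))  ≡⟨ count-allVecsOf-suc (allᵛ P) xs ⟩
  sum (map _ xs)                         ≡⟨ sum-map-indicator _ P K xs tails ⟩
  count P xs * K                         ≡⟨ cong (count P xs *_) (count-allᵛ P xs t) ⟩
  count P xs * count P xs ^ t            ∎
  where
  open ≡-Reasoning
  K = count (allᵛ P) (allVecsOf xs t)
  tails : ∀ x → count (λ v → P x ∧ allᵛ P v) (allVecsOf xs t) ≡ (if P x then K else 0)
  tails x with P x
  ... | true  = refl
  ... | false = count-none _ (allVecsOf xs t) (λ _ ())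

length-allVecsOf : (xs : List A) (n : ℕ) → length (allVecsOf xs n) ≡ length xs ^ n
length-allVecsOf xs n = begin
  length (allVecsOf xs n)               ≡⟨ count-all (allᵛ (λ _ → true)) (allVecsOf xs n) (allᵛ-true n) ⟨
  count (allᵛ (λ _ → true)) (allVecsOf xs n) ≡⟨ count-allᵛ (λ _ → true) xs n ⟩
  count (λ _ → true) xs ^ n             ≡⟨ cong (_^ n) (count-all (λ _ → true) xs (λ _ → refl)) ⟩
  length xs ^ n                         ∎
  where
  open ≡-Reasoning
  allᵛ-true : ∀ n (v : Vec A n) → allᵛ (λ _ → true) v ≡ true
  allᵛ-true _ []      = refl
  allᵛ-true _ (_ ∷ v) = allᵛ-true _ v

module _ {b : ℕ} (1<b : 1 < b) where

  ^-cancelʳ-≤ : ∀ {i j} → b ^ i ≤ b ^ j → i ≤ j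
  ^-cancelʳ-≤ {i} {j} bⁱ≤bʲ with ℕₚ.≤-<-connex i j
  ... | inj₁ i≤j = i≤j
  ... | inj₂ j<i = ⊥-elim (ℕₚ.<⇒≱ (ℕₚ.^-monoʳ-< b 1<b j<i) bⁱ≤bʲ)

  ^-injectiveʳ : ∀ {i j} → b ^ i ≡ b ^ j → i ≡ j
  ^-injectiveʳ eq = ℕₚ.≤-antisym (^-cancelʳ-≤ (ℕₚ.≤-reflexive eq)) (^-cancelʳ-≤ (ℕₚ.≤-reflexive (sym eq)))

  n<b^n : ∀ n → n < b ^ n
  n<b^n zero    = s≤s z≤n
  n<b^n (suc n) = ℕₚ.≤-trans (s≤s (n<b^n n)) (ℕₚ.^-monoʳ-< b 1<b (ℕₚ.n<1+n n))

-- The loop of logq, with the base and the target as explicit arguments.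
search : (b c fuel k : ℕ) → ℕ
search b c zero       k = k
search b c (suc fuel) k = if b ^ k ≡ᵇ c then k else search b c fuel (suc k)

search-unique : ∀ b c {G : ℕ → ℕ → ℕ} →
  (∀ f k → G (suc f) k ≡ (if b ^ k ≡ᵇ c then k else G f (suc k))) →
  (∀ k → G zero k ≡ k) → ∀ f k → G f k ≡ search b c f k
search-unique b c         step base zero    k = base k
search-unique b c {G = G} step base (suc f) k =
  trans (step f k) (cong (if b ^ k ≡ᵇ c then k else_) (search-unique b c {G} step base f (suc k)))

-- The local function of logq cannot be named, so it enters as the solution of the
-- metavariable in the type of logq-go≡search, which is fixed by the use below.
mutual
  logq-go≡search : ∀ b c f k → _ ≡ search b c f k
  logq-go≡search b c = search-unique b c (λ _ _ → refl) (λ _ → refl)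

  logq≡search : ∀ b c → logq b c ≡ search b c c 0
  logq≡search b zero    = refl
  logq≡search b (suc c) with suc c | 1
  ... | w | k = cong (if 0 ≡ᵇ c then 0 else_) (logq-go≡search b w c k)

search-^ : ∀ {b} → 1 < b → ∀ j f k → k ≤ j → j < k + f → search b (b ^ j) f k ≡ j
search-^ 1<b j zero    k k≤j j<k+0 = ⊥-elim (ℕₚ.<⇒≱ j<k+0 (subst (_≤ j) (sym (ℕₚ.+-identityʳ k)) k≤j))
search-^ {b} 1<b j (suc f) k k≤j j<k+1+f with b ^ k ≡ᵇ b ^ j in found
... | true  = ^-injectiveʳ 1<b (ℕₚ.≡ᵇ⇒≡ _ _ (subst T (sym found) _))
... | false with ℕₚ.m≤n⇒m<n∨m≡n k≤j
...   | inj₁ k<j  = search-^ 1<b j f (suc k) k<j (ℕₚ.≤-trans j<k+1+f (ℕₚ.≤-reflexive (ℕₚ.+-suc k f)))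
...   | inj₂ refl = ⊥-elim (subst T found (ℕₚ.≡⇒≡ᵇ (b ^ k) (b ^ k) refl))

logq-^ : ∀ {b} → 1 < b → ∀ j → logq b (b ^ j) ≡ j
logq-^ {b} 1<b j = trans (logq≡search b (b ^ j)) (search-^ 1<b j (b ^ j) 0 z≤n (n<b^n 1<b j))

m∸[1+m∸d]<d : ∀ m d → suc (m ∸ d) ≤ m → m ∸ suc (m ∸ d) < d
m∸[1+m∸d]<d m zero    m<m = ⊥-elim (ℕₚ.<-irrefl refl m<m)
m∸[1+m∸d]<d m (suc d) _ with ℕₚ.≤-<-connex (suc d) m
... | inj₁ d<m = begin-strict
  m ∸ suc (m ∸ suc d)  ≡⟨ cong (m ∸_) (ℕₚ.+-∸-assoc 1 d<m) ⟨
  m ∸ (m ∸ d)          ≡⟨ ℕₚ.m∸[m∸n]≡n (ℕₚ.<⇒≤ d<m) ⟩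
  d                    <⟨ ℕₚ.n<1+n d ⟩
  suc d                ∎
  where open ℕₚ.≤-Reasoning
... | inj₂ m<d = begin-strict
  m ∸ suc (m ∸ suc d)  ≡⟨ cong (λ x → m ∸ suc x) (ℕₚ.m≤n⇒m∸n≡0 (ℕₚ.<⇒≤ m<d)) ⟩
  m ∸ 1                ≤⟨ ℕₚ.m∸n≤m m 1 ⟩
  m                    <⟨ m<d ⟩
  suc d                ∎
  where open ℕₚ.≤-Reasoning

≤-positive-combination : ∀ {u e₁ e₂} a c → 0 < a + c → u ≤ e₁ → u ≤ e₂ → u ≤ c * e₁ + a * e₂
≤-positive-combination {e₁ = e₁} {e₂} a (suc c) _ u≤e₁ _ =
  ℕₚ.≤-trans u≤e₁ (ℕₚ.≤-trans (ℕₚ.m≤m+n e₁ (c * e₁)) (ℕₚ.m≤m+n (suc c * e₁) (a * e₂)))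
≤-positive-combination {e₂ = e₂} (suc a) zero _ _ u≤e₂ = ℕₚ.≤-trans u≤e₂ (ℕₚ.m≤m+n e₂ (a * e₂))

-- Finite modules and the sizes of their submodules

module _ (F : FiniteField) where

  open FiniteField F renaming (_+_ to _+ᶠ_; _*_ to _*ᶠ_)

  fieldRing : CommutativeRing 0ℓ 0ℓ
  fieldRing = record { isCommutativeRing = isCommutativeRing }

  open CommutativeRing fieldRing
    using (+-assoc; +-comm; +-identityˡ; +-identityʳ; -‿inverseˡ; -‿inverseʳ;
           *-assoc; *-comm; *-identityˡ; *-identityʳ; distribˡ; distribʳ; zeroˡ; zeroʳ; +-commutativeSemigroup)
  open RingProperties (CommutativeRing.ring fieldRing) using (-1*x≈-x; -‿distribˡ-*; -‿distribʳ-*; +-inverseˡ-unique)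
  open CommutativeSemigroupProperties +-commutativeSemigroup using (interchange)

  1<q : 1 < q
  1<q = unique-⊆⇒length-≤ {xs = 0# ∷ 1# ∷ []} ((0≢1 ∷ []) ∷ [] ∷ []) (λ {x} _ → complete x)

  -1*x+x≡0 : ∀ x → (- 1#) *ᶠ x +ᶠ x ≡ 0#
  -1*x+x≡0 x = trans (cong (_+ᶠ x) (-1*x≈-x x)) (-‿inverseˡ x)

  x+-1*x≡0 : ∀ x → x +ᶠ (- 1#) *ᶠ x ≡ 0#
  x+-1*x≡0 x = trans (+-comm x _) (-1*x+x≡0 x)

  record EnumModule : Set₁ where
    infixl 6 _+ᴹ_
    infixr 7 _*ᴹ_
    field
      Elem          : Set
      0ᴹ            : Elem
      _+ᴹ_          : Elem → Elem → Elem
      _*ᴹ_          : Carrier → Elem → Elem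
      enum          : List Elem
      ∈-enum        : ∀ x → x ∈ enum
      enum-unique   : Unique enum
      +ᴹ-assoc      : ∀ x y z → (x +ᴹ y) +ᴹ z ≡ x +ᴹ (y +ᴹ z)
      +ᴹ-identityˡ  : ∀ x → 0ᴹ +ᴹ x ≡ x
      +ᴹ-identityʳ  : ∀ x → x +ᴹ 0ᴹ ≡ x
      -1*ᴹ-inverseˡ : ∀ x → (- 1#) *ᴹ x +ᴹ x ≡ 0ᴹ
      -1*ᴹ-inverseʳ : ∀ x → x +ᴹ (- 1#) *ᴹ x ≡ 0ᴹ
      *ᴹ-zeroʳ      : ∀ c → c *ᴹ 0ᴹ ≡ 0ᴹ

  record IsSubmodule (M : EnumModule) (p : EnumModule.Elem M → Bool) : Set where
    open EnumModule M
    field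
      0ᴹ∈      : p 0ᴹ ≡ true
      +-closed : ∀ {u v} → p u ≡ true → p v ≡ true → p (u +ᴹ v) ≡ true
      *-closed : ∀ c {v} → p v ≡ true → p (c *ᴹ v) ≡ true

  HasPowerSizedSubmodules : EnumModule → Set
  HasPowerSizedSubmodules M = ∀ p → IsSubmodule M p → ∃ λ j → count p (EnumModule.enum M) ≡ q ^ j

  Fᴹ : EnumModule
  Fᴹ = record
    { Elem = Carrier ; 0ᴹ = 0# ; _+ᴹ_ = _+ᶠ_ ; _*ᴹ_ = _*ᶠ_ ; enum = elements ; ∈-enum = complete ; enum-unique = unique
    ; +ᴹ-assoc = +-assoc ; +ᴹ-identityˡ = +-identityˡ ; +ᴹ-identityʳ = +-identityʳ
    ; -1*ᴹ-inverseˡ = -1*x+x≡0 ; -1*ᴹ-inverseʳ = x+-1*x≡0 ; *ᴹ-zeroʳ = zeroʳ }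

  Vecᴹ : EnumModule → ℕ → EnumModule
  Vecᴹ M N = record
    { Elem = Vec Elem N ; 0ᴹ = replicate N 0ᴹ ; _+ᴹ_ = zipWith _+ᴹ_ ; _*ᴹ_ = λ c → Vec.map (c *ᴹ_)
    ; enum = allVecsOf enum N ; ∈-enum = ∈-allVecsOf ∈-enum N ; enum-unique = allVecsOf-unique enum-unique N
    ; +ᴹ-assoc = assoc ; +ᴹ-identityˡ = identityˡ ; +ᴹ-identityʳ = identityʳ
    ; -1*ᴹ-inverseˡ = inverseˡ ; -1*ᴹ-inverseʳ = inverseʳ ; *ᴹ-zeroʳ = zeroʳᵛ }
    where
    open EnumModule M
    assoc : ∀ {N} (x y z : Vec Elem N) → zipWith _+ᴹ_ (zipWith _+ᴹ_ x y) z ≡ zipWith _+ᴹ_ x (zipWith _+ᴹ_ y z)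
    assoc []       []       []       = refl
    assoc (x ∷ xs) (y ∷ ys) (z ∷ zs) = cong₂ _∷_ (+ᴹ-assoc x y z) (assoc xs ys zs)
    identityˡ : ∀ {N} (x : Vec Elem N) → zipWith _+ᴹ_ (replicate N 0ᴹ) x ≡ x
    identityˡ []       = refl
    identityˡ (x ∷ xs) = cong₂ _∷_ (+ᴹ-identityˡ x) (identityˡ xs)
    identityʳ : ∀ {N} (x : Vec Elem N) → zipWith _+ᴹ_ x (replicate N 0ᴹ) ≡ x
    identityʳ []       = refl
    identityʳ (x ∷ xs) = cong₂ _∷_ (+ᴹ-identityʳ x) (identityʳ xs)
    inverseˡ : ∀ {N} (x : Vec Elem N) → zipWith _+ᴹ_ (Vec.map ((- 1#) *ᴹ_) x) x ≡ replicate N 0ᴹ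
    inverseˡ []       = refl
    inverseˡ (x ∷ xs) = cong₂ _∷_ (-1*ᴹ-inverseˡ x) (inverseˡ xs)
    inverseʳ : ∀ {N} (x : Vec Elem N) → zipWith _+ᴹ_ x (Vec.map ((- 1#) *ᴹ_) x) ≡ replicate N 0ᴹ
    inverseʳ []       = refl
    inverseʳ (x ∷ xs) = cong₂ _∷_ (-1*ᴹ-inverseʳ x) (inverseʳ xs)
    zeroʳᵛ : ∀ {N} c → Vec.map (c *ᴹ_) (replicate N 0ᴹ) ≡ replicate N 0ᴹ
    zeroʳᵛ {zero}  c = refl
    zeroʳᵛ {suc N} c = cong₂ _∷_ (*ᴹ-zeroʳ c) (zeroʳᵛ c)

  count-only-0# : (p : Carrier → Bool) → p 0# ≡ true → (∀ x → p x ≡ true → x ≡ 0#) → count p elements ≡ 1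
  count-only-0# p p0 only-0 = ℕₚ.≤-antisym
    (unique-⊆⇒length-≤ {ys = 0# ∷ []} (filterᵇ-unique p unique)
      (λ {x} x∈ → here (only-0 x (proj₂ (∈-filterᵇ⁻ p {xs = elements} x∈)))))
    (unique-⊆⇒length-≤ {xs = 0# ∷ []} ([] ∷ []) (λ { (here refl) → ∈-filterᵇ⁺ p (complete 0#) p0 }))

  Fᴹ-submodule-zero-or-full : ∀ {p} → IsSubmodule Fᴹ p → (∀ x → p x ≡ true → x ≡ 0#) ⊎ (∀ x → p x ≡ true)
  Fᴹ-submodule-zero-or-full {p} S with Any.any? (λ c → (p c Boolₚ.≟ true) ×-dec ¬? (c ≟ 0#)) elements
  ... | yes c∈ with c , pc , c≢0 ← Any.satisfied c∈ = inj₂ full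
    where
    c⁻¹ = proj₁ (inverse c c≢0)
    full : ∀ x → p x ≡ true
    full x = subst (λ y → p y ≡ true) x*c⁻¹*c≡x (IsSubmodule.*-closed S (x *ᶠ c⁻¹) pc)
      where
      x*c⁻¹*c≡x : (x *ᶠ c⁻¹) *ᶠ c ≡ x
      x*c⁻¹*c≡x = trans (*-assoc x c⁻¹ c)
        (trans (cong (x *ᶠ_) (trans (*-comm c⁻¹ c) (proj₂ (inverse c c≢0)))) (*-identityʳ x))
  ... | no ∄c = inj₁ only-0
    where
    only-0 : ∀ x → p x ≡ true → x ≡ 0#
    only-0 x px with x ≟ 0#
    ... | yes x≡0 = x≡0
    ... | no  x≢0 = ⊥-elim (∄c (Any.map (λ { refl → px , x≢0 }) (complete x)))

  Fᴹ-powerSized : HasPowerSizedSubmodules Fᴹ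
  Fᴹ-powerSized p S with Fᴹ-submodule-zero-or-full S
  ... | inj₁ only-0 = 0 , count-only-0# p (IsSubmodule.0ᴹ∈ S) only-0
  ... | inj₂ full   = 1 , trans (count-all p elements full) (sym (ℕₚ.*-identityʳ q))

  module HeadDecomposition (M : EnumModule) (N : ℕ) {p : Vec (EnumModule.Elem M) (suc N) → Bool}
                           (S : IsSubmodule (Vecᴹ M (suc N)) p) where

    open EnumModule M
    open IsSubmodule S
    private
      module Mᴺ = EnumModule (Vecᴹ M N)

    heads : Elem → Bool
    heads a = any (λ v → p (a ∷ v)) Mᴺ.enum

    headKernel : Vec Elem N → Bool
    headKernel v = p (0ᴹ ∷ v)

    heads-isSubmodule : IsSubmodule M heads
    heads-isSubmodule = record
      { 0ᴹ∈      = any≡true⁺ _ Mᴺ.enum (Mᴺ.∈-enum Mᴺ.0ᴹ) 0ᴹ∈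
      ; +-closed = λ a∈ b∈ →
          let v , _ , pav = any≡true⁻ _ Mᴺ.enum a∈
              w , _ , pbw = any≡true⁻ _ Mᴺ.enum b∈
          in any≡true⁺ _ Mᴺ.enum (Mᴺ.∈-enum (v Mᴺ.+ᴹ w)) (+-closed pav pbw)
      ; *-closed = λ c a∈ →
          let v , _ , pav = any≡true⁻ _ Mᴺ.enum a∈
          in any≡true⁺ _ Mᴺ.enum (Mᴺ.∈-enum (c Mᴺ.*ᴹ v)) (*-closed c pav)
      }

    headKernel-isSubmodule : IsSubmodule (Vecᴹ M N) headKernel
    headKernel-isSubmodule = record
      { 0ᴹ∈      = 0ᴹ∈
      ; +-closed = λ {v} {w} pv pw → subst (λ a → p (a ∷ v Mᴺ.+ᴹ w) ≡ true) (+ᴹ-identityˡ 0ᴹ) (+-closed pv pw)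
      ; *-closed = λ c {v} pv → subst (λ a → p (a ∷ c Mᴺ.*ᴹ v) ≡ true) (*ᴹ-zeroʳ c) (*-closed c pv)
      }

    -- Translation by (a ∷ v₀) identifies the fibre over 0ᴹ with the fibre over a.
    fiber-size : ∀ {a v₀} → p (a ∷ v₀) ≡ true → count (λ v → p (a ∷ v)) Mᴺ.enum ≡ count headKernel Mᴺ.enum
    fiber-size {a} {v₀} pav₀ = count-≡-bijection _ _ (λ v → v Mᴺ.+ᴹ (- 1#) Mᴺ.*ᴹ v₀) (λ w → w Mᴺ.+ᴹ v₀)
      Mᴺ.enum-unique Mᴺ.∈-enum Mᴺ.enum-unique Mᴺ.∈-enum
      (λ v pav → subst (λ b → p (b ∷ v Mᴺ.+ᴹ (- 1#) Mᴺ.*ᴹ v₀) ≡ true) (-1*ᴹ-inverseʳ a)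
                   (+-closed pav (*-closed (- 1#) pav₀)))
      (λ w pw → subst (λ b → p (b ∷ w Mᴺ.+ᴹ v₀) ≡ true) (+ᴹ-identityˡ a) (+-closed pw pav₀))
      (λ v _ → trans (Mᴺ.+ᴹ-assoc v _ v₀) (trans (cong (v Mᴺ.+ᴹ_) (Mᴺ.-1*ᴹ-inverseˡ v₀)) (Mᴺ.+ᴹ-identityʳ v)))
      (λ w _ → trans (Mᴺ.+ᴹ-assoc w v₀ _) (trans (cong (w Mᴺ.+ᴹ_) (Mᴺ.-1*ᴹ-inverseʳ v₀)) (Mᴺ.+ᴹ-identityʳ w)))

    count≡heads*headKernel : count p (allVecsOf enum (suc N)) ≡ count heads enum * count headKernel Mᴺ.enum
    count≡heads*headKernel =
      trans (count-allVecsOf-suc p enum) (sum-map-indicator _ heads _ enum fiber)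
      where
      fiber : ∀ a → count (λ v → p (a ∷ v)) Mᴺ.enum ≡ (if heads a then count headKernel Mᴺ.enum else 0)
      fiber a with heads a in a∈
      ... | true  = fiber-size (proj₂ (proj₂ (any≡true⁻ _ Mᴺ.enum a∈)))
      ... | false = count-none _ Mᴺ.enum (λ v∈ pav → false≢true
                      (trans (sym a∈) (any≡true⁺ _ Mᴺ.enum v∈ pav)))

    count-power : HasPowerSizedSubmodules M → HasPowerSizedSubmodules (Vecᴹ M N) →
                  ∃ λ k → count p (allVecsOf enum (suc N)) ≡ q ^ k
    count-power M-powerSized Mᴺ-powerSized
      with i , |heads|≡qⁱ  ← M-powerSized heads heads-isSubmodule
         | j , |kernel|≡qʲ ← Mᴺ-powerSized headKernel headKernel-isSubmodule
      = i + j , (begin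
        count p (allVecsOf enum (suc N))            ≡⟨ count≡heads*headKernel ⟩
        count heads enum * count headKernel Mᴺ.enum ≡⟨ cong₂ _*_ |heads|≡qⁱ |kernel|≡qʲ ⟩
        q ^ i * q ^ j                               ≡⟨ ℕₚ.^-distribˡ-+-* q i j ⟨
        q ^ (i + j)                                 ∎)
      where open ≡-Reasoning

  Vecᴹ-powerSized : ∀ {M} → HasPowerSizedSubmodules M → ∀ N → HasPowerSizedSubmodules (Vecᴹ M N)
  Vecᴹ-powerSized M-powerSized zero    p S = 0 , count-all p ([] ∷ []) (λ { [] → IsSubmodule.0ᴹ∈ S })
  Vecᴹ-powerSized M-powerSized (suc N) p S =
    HeadDecomposition.count-power _ N S M-powerSized (Vecᴹ-powerSized M-powerSized N)

  Fⁿ : ℕ → EnumModule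
  Fⁿ = Vecᴹ Fᴹ

  Fⁿˣᵐ : ℕ → ℕ → EnumModule
  Fⁿˣᵐ n m = Vecᴹ (Fⁿ m) n

  subspace-isSubmodule : ∀ {n} (X : Subspace (VecSpace F n)) → IsSubmodule (Fⁿ n) (mem X)
  subspace-isSubmodule X = record { 0ᴹ∈ = mem-zero X ; +-closed = mem-add X _ _ ; *-closed = λ c → mem-smul X c _ }

  code-isSubmodule : ∀ {n m} (C : Code F n m) → IsSubmodule (Fⁿˣᵐ n m) (mem C)
  code-isSubmodule C = record { 0ᴹ∈ = mem-zero C ; +-closed = mem-add C _ _ ; *-closed = λ c → mem-smul C c _ }

  ≡q^logq : ∀ {c} → (∃ λ j → c ≡ q ^ j) → c ≡ q ^ logq q c
  ≡q^logq (j , refl) = cong (q ^_) (sym (logq-^ 1<q j))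

  count≡q^dimOf-vectors : ∀ {n p} → IsSubmodule (Fⁿ n) p → count p (allVects F n) ≡ q ^ dimOf (VecSpace F n) p
  count≡q^dimOf-vectors S = ≡q^logq (Vecᴹ-powerSized Fᴹ-powerSized _ _ S)

  count≡q^dimOf-matrices : ∀ {n m p} → IsSubmodule (Fⁿˣᵐ n m) p →
                           count p (allMats F n m) ≡ q ^ dimOf (MatSpace F n m) p
  count≡q^dimOf-matrices S = ≡q^logq (Vecᴹ-powerSized (Vecᴹ-powerSized Fᴹ-powerSized _) _ _ S)

  dim≤n*m : ∀ {n m} (C : Code F n m) → dim C ≤ n * m
  dim≤n*m {n} {m} C = ^-cancelʳ-≤ 1<q (begin
    q ^ dim C                      ≡⟨ count≡q^dimOf-matrices (code-isSubmodule C) ⟨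
    count (mem C) (allMats F n m)  ≤⟨ count≤length (mem C) (allMats F n m) ⟩
    length (allMats F n m)         ≡⟨ length-allVecsOf (allVects F m) n ⟩
    length (allVects F m) ^ n      ≡⟨ cong (_^ n) (length-allVecsOf elements m) ⟩
    (q ^ m) ^ n                    ≡⟨ ℕₚ.^-*-assoc q m n ⟩
    q ^ (m * n)                    ≡⟨ cong (q ^_) (ℕₚ.*-comm m n) ⟩
    q ^ (n * m)                    ∎)
    where open ℕₚ.≤-Reasoning

  -- Orthogonal complements

  infix 8 _·_
  _·_ : ∀ {n} → Vect F n → Vect F n → Carrier
  _·_ = dot F

  ·-distribʳ-+ : ∀ {n} (u u′ v : Vect F n) → zipWith _+ᶠ_ u u′ · v ≡ u · v +ᶠ u′ · v
  ·-distribʳ-+ []       []         []       = sym (+-identityˡ 0#)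
  ·-distribʳ-+ (x ∷ u) (x′ ∷ u′) (y ∷ v) =
    trans (cong₂ _+ᶠ_ (distribʳ y x x′) (·-distribʳ-+ u u′ v)) (interchange (x *ᶠ y) (x′ *ᶠ y) (u · v) (u′ · v))

  ·-distribˡ-+ : ∀ {n} (u v v′ : Vect F n) → u · zipWith _+ᶠ_ v v′ ≡ u · v +ᶠ u · v′
  ·-distribˡ-+ []      []      []         = sym (+-identityˡ 0#)
  ·-distribˡ-+ (x ∷ u) (y ∷ v) (y′ ∷ v′) =
    trans (cong₂ _+ᶠ_ (distribˡ x y y′) (·-distribˡ-+ u v v′)) (interchange (x *ᶠ y) (x *ᶠ y′) (u · v) (u · v′))

  ·-*ˡ : ∀ {n} c (u v : Vect F n) → Vec.map (c *ᶠ_) u · v ≡ c *ᶠ (u · v)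
  ·-*ˡ c []      []      = sym (zeroʳ c)
  ·-*ˡ c (x ∷ u) (y ∷ v) = trans (cong₂ _+ᶠ_ (*-assoc c x y) (·-*ˡ c u v)) (sym (distribˡ c (x *ᶠ y) (u · v)))

  ·-*ʳ : ∀ {n} c (u v : Vect F n) → u · Vec.map (c *ᶠ_) v ≡ c *ᶠ (u · v)
  ·-*ʳ c []      []      = sym (zeroʳ c)
  ·-*ʳ c (x ∷ u) (y ∷ v) = trans (cong₂ _+ᶠ_ x*cy≡c*xy (·-*ʳ c u v)) (sym (distribˡ c (x *ᶠ y) (u · v)))
    where
    x*cy≡c*xy : x *ᶠ (c *ᶠ y) ≡ c *ᶠ (x *ᶠ y)
    x*cy≡c*xy = trans (sym (*-assoc x c y)) (trans (cong (_*ᶠ y) (*-comm x c)) (*-assoc c x y))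

  ·-zeroʳ : ∀ {n} (u : Vect F n) → u · replicate n 0# ≡ 0#
  ·-zeroʳ []      = refl
  ·-zeroʳ (x ∷ u) = trans (cong₂ _+ᶠ_ (zeroʳ x) (·-zeroʳ u)) (+-identityˡ 0#)

  -- inPerp F X is orth (mem X); orth also applies to predicates not packaged as a Subspace.
  orth : ∀ {n} → (Vect F n → Bool) → Vect F n → Bool
  orth {n} p v = all (λ u → not (p u) ∨ does ((u · v) ≟ 0#)) (allVects F n)

  orth≡true⁻ : ∀ {n} (p : Vect F n → Bool) {v} → orth p v ≡ true → ∀ {u} → p u ≡ true → u · v ≡ 0#
  orth≡true⁻ {n} p {v} v∈ {u} pu with all≡true⁻ _ (allVects F n) v∈ (EnumModule.∈-enum (Fⁿ n) u)
  ... | u⊥v rewrite pu = dec-true⁻ ((u · v) ≟ 0#) u⊥v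

  orth≡true⁺ : ∀ {n} (p : Vect F n → Bool) {v} → (∀ {u} → p u ≡ true → u · v ≡ 0#) → orth p v ≡ true
  orth≡true⁺ {n} p {v} ⊥v = all≡true⁺ _ (allVects F n) (λ {u} _ → ⊥u u)
    where
    ⊥u : ∀ u → (not (p u) ∨ does ((u · v) ≟ 0#)) ≡ true
    ⊥u u with p u in pu
    ... | false = refl
    ... | true  = dec-true ((u · v) ≟ 0#) (⊥v pu)

  orth-isSubmodule : ∀ {n} (p : Vect F n → Bool) → IsSubmodule (Fⁿ n) (orth p)
  orth-isSubmodule p = record
    { 0ᴹ∈      = orth≡true⁺ p (λ {u} _ → ·-zeroʳ u)
    ; +-closed = λ {v} {v′} v∈ v′∈ → orth≡true⁺ p λ {u} pu → begin
        u · zipWith _+ᶠ_ v v′ ≡⟨ ·-distribˡ-+ u v v′ ⟩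
        u · v +ᶠ u · v′       ≡⟨ cong₂ _+ᶠ_ (orth≡true⁻ p v∈ pu) (orth≡true⁻ p v′∈ pu) ⟩
        0# +ᶠ 0#              ≡⟨ +-identityˡ 0# ⟩
        0#                    ∎
    ; *-closed = λ c {v} v∈ → orth≡true⁺ p λ {u} pu →
        trans (·-*ʳ c u v) (trans (cong (c *ᶠ_) (orth≡true⁻ p v∈ pu)) (zeroʳ c))
    }
    where open ≡-Reasoning

  module OrthHeadDecomposition {n} {p : Vect F (suc n) → Bool} (S : IsSubmodule (Fⁿ (suc n)) p) where

    open HeadDecomposition Fᴹ n S public
    open IsSubmodule S
    open ≡-Reasoning
    private
      module Fⁿ = EnumModule (Fⁿ n)
      K₀ K₀⊥ : ℕ
      K₀  = count headKernel Fⁿ.enum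
      K₀⊥ = count (orth headKernel) Fⁿ.enum

    orth-tail : ∀ {c w} → orth p (c ∷ w) ≡ true → orth headKernel w ≡ true
    orth-tail {c} {w} cw∈ = orth≡true⁺ headKernel λ {u} pu → begin
      u · w               ≡⟨ +-identityˡ (u · w) ⟨
      0# +ᶠ u · w         ≡⟨ cong (_+ᶠ u · w) (zeroˡ c) ⟨
      (0# ∷ u) · (c ∷ w)  ≡⟨ orth≡true⁻ p cw∈ pu ⟩
      0#                  ∎

    -- Given 1# ∷ w₀ in p, every head occurs, and dropping the first coordinate is a bijection
    -- from orth p onto orth headKernel, with inverse w ↦ -(w₀ · w) ∷ w.
    module Pivot {w₀} (pw₀ : p (1# ∷ w₀) ≡ true) where

      count-heads : count heads elements ≡ q
      count-heads = count-all heads elements λ a →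
        any≡true⁺ _ Fⁿ.enum (Fⁿ.∈-enum (Vec.map (a *ᶠ_) w₀))
          (subst (λ b → p (b ∷ Vec.map (a *ᶠ_) w₀) ≡ true) (*-identityʳ a) (*-closed a pw₀))

      extend : Vect F n → Vect F (suc n)
      extend w = (- (w₀ · w)) ∷ w

      extend-orth : ∀ {w} → orth headKernel w ≡ true → orth p (extend w) ≡ true
      extend-orth {w} w∈ = orth≡true⁺ p λ { {a ∷ v} pav → begin
        a *ᶠ (- (w₀ · w)) +ᶠ v · w
          ≡⟨ cong (_+ᶠ v · w) (trans (sym (-‿distribʳ-* a _)) (-‿distribˡ-* a _)) ⟩
        (- a) *ᶠ (w₀ · w) +ᶠ v · w                    ≡⟨ +-comm _ (v · w) ⟩
        v · w +ᶠ (- a) *ᶠ (w₀ · w)                    ≡⟨ cong (v · w +ᶠ_) (·-*ˡ (- a) w₀ w) ⟨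
        v · w +ᶠ Vec.map ((- a) *ᶠ_) w₀ · w           ≡⟨ ·-distribʳ-+ v _ w ⟨
        zipWith _+ᶠ_ v (Vec.map ((- a) *ᶠ_) w₀) · w   ≡⟨ orth≡true⁻ headKernel w∈ (kernel∋ pav) ⟩
        0#                                            ∎ }
        where
        kernel∋ : ∀ {a v} → p (a ∷ v) ≡ true → headKernel (zipWith _+ᶠ_ v (Vec.map ((- a) *ᶠ_) w₀)) ≡ true
        kernel∋ {a} {v} pav = subst (λ b → p (b ∷ zipWith _+ᶠ_ v (Vec.map ((- a) *ᶠ_) w₀)) ≡ true)
          (trans (cong (a +ᶠ_) (*-identityʳ (- a))) (-‿inverseʳ a)) (+-closed pav (*-closed (- a) pw₀))

      extend-tail : ∀ {x} → orth p x ≡ true → extend (Vec.tail x) ≡ x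
      extend-tail {c ∷ w} cw∈ = cong (_∷ w) (sym (+-inverseˡ-unique c (w₀ · w)
        (trans (cong (_+ᶠ w₀ · w) (sym (*-identityˡ c))) (orth≡true⁻ p cw∈ pw₀))))

      count-orth : count (orth p) (allVects F (suc n)) ≡ K₀⊥
      count-orth = count-≡-bijection (orth p) (orth headKernel) Vec.tail extend
        (EnumModule.enum-unique (Fⁿ (suc n))) (EnumModule.∈-enum (Fⁿ (suc n))) Fⁿ.enum-unique Fⁿ.∈-enum
        (λ { (c ∷ w) → orth-tail }) (λ w → extend-orth) (λ x → extend-tail) (λ w _ → refl)

      count*count-orth : count p (allVects F (suc n)) * count (orth p) (allVects F (suc n)) ≡ q * (K₀ * K₀⊥)
      count*count-orth = begin
        count p (allVects F (suc n)) * count (orth p) (allVects F (suc n))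
                                          ≡⟨ cong₂ _*_ count≡heads*headKernel count-orth ⟩
        count heads elements * K₀ * K₀⊥   ≡⟨ cong (λ h → h * K₀ * K₀⊥) count-heads ⟩
        q * K₀ * K₀⊥                      ≡⟨ ℕₚ.*-assoc q K₀ K₀⊥ ⟩
        q * (K₀ * K₀⊥)                    ∎

    -- Otherwise every vector of p starts with 0#, so orth p (c ∷ w) does not depend on c.
    module NoPivot (no-pivot : heads 1# ≡ false) where

      heads-only-0# : ∀ a → heads a ≡ true → a ≡ 0#
      heads-only-0# a a∈ with a ≟ 0# | any≡true⁻ _ Fⁿ.enum a∈
      ... | yes a≡0 | _           = a≡0
      ... | no  a≢0 | v , _ , pav =
        ⊥-elim (false≢true (trans (sym no-pivot) (any≡true⁺ _ Fⁿ.enum (Fⁿ.∈-enum _) p[1∷a⁻¹v])))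
        where
        a⁻¹ = proj₁ (inverse a a≢0)
        p[1∷a⁻¹v] : p (1# ∷ Vec.map (a⁻¹ *ᶠ_) v) ≡ true
        p[1∷a⁻¹v] = subst (λ b → p (b ∷ Vec.map (a⁻¹ *ᶠ_) v) ≡ true)
          (trans (*-comm a⁻¹ a) (proj₂ (inverse a a≢0))) (*-closed a⁻¹ pav)

      count-heads : count heads elements ≡ 1
      count-heads = count-only-0# heads (IsSubmodule.0ᴹ∈ heads-isSubmodule) heads-only-0#

      orth-cons : ∀ c w → orth p (c ∷ w) ≡ orth headKernel w
      orth-cons c w = Boolₚ.⇔→≡ {z = true} (mk⇔ orth-tail λ w∈ → orth≡true⁺ p λ { {a ∷ v} pav →
        ⊥cons (heads-only-0# a (any≡true⁺ _ Fⁿ.enum (Fⁿ.∈-enum v) pav)) pav w∈ })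
        where
        ⊥cons : ∀ {a v} → a ≡ 0# → p (a ∷ v) ≡ true → orth headKernel w ≡ true → (a ∷ v) · (c ∷ w) ≡ 0#
        ⊥cons {v = v} refl pav w∈ =
          trans (cong (_+ᶠ v · w) (zeroˡ c)) (trans (+-identityˡ _) (orth≡true⁻ headKernel w∈ pav))

      count-orth : count (orth p) (allVects F (suc n)) ≡ q * K₀⊥
      count-orth = begin
        count (orth p) (allVects F (suc n))  ≡⟨ count-allVecsOf-suc (orth p) elements ⟩
        sum (map (λ c → count (λ w → orth p (c ∷ w)) Fⁿ.enum) elements)
          ≡⟨ sum-map-indicator _ (λ _ → true) K₀⊥ elements (λ c → count-cong (orth-cons c) Fⁿ.enum) ⟩
        count (λ _ → true) elements * K₀⊥    ≡⟨ cong (_* K₀⊥) (count-all _ elements (λ _ → refl)) ⟩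
        q * K₀⊥                              ∎

      count*count-orth : count p (allVects F (suc n)) * count (orth p) (allVects F (suc n)) ≡ q * (K₀ * K₀⊥)
      count*count-orth = begin
        count p (allVects F (suc n)) * count (orth p) (allVects F (suc n))
                                                ≡⟨ cong₂ _*_ count≡heads*headKernel count-orth ⟩
        count heads elements * K₀ * (q * K₀⊥)   ≡⟨ cong (λ h → h * K₀ * (q * K₀⊥)) count-heads ⟩
        1 * K₀ * (q * K₀⊥)                      ≡⟨ cong (_* (q * K₀⊥)) (ℕₚ.*-identityˡ K₀) ⟩
        K₀ * (q * K₀⊥)                          ≡⟨ x*[y*z]≡y*[x*z] K₀ q K₀⊥ ⟩
        q * (K₀ * K₀⊥)                          ∎

    count*count-orth : count p (allVects F (suc n)) * count (orth p) (allVects F (suc n)) ≡ q * (K₀ * K₀⊥)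
    count*count-orth with heads 1# in pivot?
    ... | true  = Pivot.count*count-orth (proj₂ (proj₂ (any≡true⁻ _ Fⁿ.enum pivot?)))
    ... | false = NoPivot.count*count-orth pivot?

  count*count-orth≡q^n : ∀ n {p} → IsSubmodule (Fⁿ n) p → count p (allVects F n) * count (orth p) (allVects F n) ≡ q ^ n
  count*count-orth≡q^n zero    {p} S = cong₂ _*_
    (count-all p ([] ∷ []) (λ { [] → IsSubmodule.0ᴹ∈ S }))
    (count-all (orth p) ([] ∷ []) (λ { [] → IsSubmodule.0ᴹ∈ (orth-isSubmodule p) }))
  count*count-orth≡q^n (suc n) S = trans count*count-orth (cong (q *_) (count*count-orth≡q^n n headKernel-isSubmodule))
    where open OrthHeadDecomposition S

  dim+dim-perp : ∀ {n} (X : Subspace (VecSpace F n)) → dim X + dimOf (VecSpace F n) (inPerp F X) ≡ n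
  dim+dim-perp {n} X = ^-injectiveʳ 1<q (begin
    q ^ (dim X + dimOf (VecSpace F n) (inPerp F X))  ≡⟨ ℕₚ.^-distribˡ-+-* q (dim X) (dimOf (VecSpace F n) (inPerp F X)) ⟩
    q ^ dim X * q ^ dimOf (VecSpace F n) (inPerp F X)
      ≡⟨ cong₂ _*_ (count≡q^dimOf-vectors (subspace-isSubmodule X)) (count≡q^dimOf-vectors (orth-isSubmodule (mem X))) ⟨
    count (mem X) (allVects F n) * count (inPerp F X) (allVects F n) ≡⟨ count*count-orth≡q^n n (subspace-isSubmodule X) ⟩
    q ^ n                                            ∎)
    where open ≡-Reasoning

  mulVec-zero : ∀ {n m} (D : Mat F n m) → mulVec F D (replicate m 0#) ≡ replicate n 0#
  mulVec-zero []      = refl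
  mulVec-zero (r ∷ D) = cong₂ _∷_ (·-zeroʳ r) (mulVec-zero D)

  mulVec-+ : ∀ {n m} (D : Mat F n m) x y → mulVec F D (zipWith _+ᶠ_ x y) ≡ zipWith _+ᶠ_ (mulVec F D x) (mulVec F D y)
  mulVec-+ []      x y = refl
  mulVec-+ (r ∷ D) x y = cong₂ _∷_ (·-distribˡ-+ r x y) (mulVec-+ D x y)

  mulVec-* : ∀ {n m} (D : Mat F n m) c x → mulVec F D (Vec.map (c *ᶠ_) x) ≡ Vec.map (c *ᶠ_) (mulVec F D x)
  mulVec-* []      c x = refl
  mulVec-* (r ∷ D) c x = cong₂ _∷_ (·-*ʳ c r x) (mulVec-* D c x)

  infix 4 _≟ᵛ_
  _≟ᵛ_ : ∀ {n} (x y : Vect F n) → Dec (x ≡ y)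
  _≟ᵛ_ = _≟V_ F

  colsp-isSubmodule : ∀ {n m} (D : Mat F n m) → IsSubmodule (Fⁿ n) (inColsp F D)
  colsp-isSubmodule {n} {m} D = record
    { 0ᴹ∈      = image (replicate m 0#) (mulVec-zero D)
    ; +-closed = λ u∈ v∈ →
        let x , _ , Dx≡u = any≡true⁻ _ (allVects F m) u∈
            y , _ , Dy≡v = any≡true⁻ _ (allVects F m) v∈
        in image (zipWith _+ᶠ_ x y)
             (trans (mulVec-+ D x y) (cong₂ (zipWith _+ᶠ_) (dec-true⁻ (_ ≟ᵛ _) Dx≡u) (dec-true⁻ (_ ≟ᵛ _) Dy≡v)))
    ; *-closed = λ c v∈ →
        let x , _ , Dx≡v = any≡true⁻ _ (allVects F m) v∈
        in image (Vec.map (c *ᶠ_) x) (trans (mulVec-* D c x) (cong (Vec.map (c *ᶠ_)) (dec-true⁻ (_ ≟ᵛ _) Dx≡v)))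
    }
    where
    image : ∀ x {v} → mulVec F D x ≡ v → inColsp F D v ≡ true
    image x Dx≡v = any≡true⁺ _ (allVects F m) (EnumModule.∈-enum (Fⁿ m) x) (dec-true (_ ≟ᵛ _) Dx≡v)

  zeroPrefix : ∀ {m} → ℕ → Vect F m → Vect F m
  zeroPrefix zero    x        = x
  zeroPrefix (suc t) []       = []
  zeroPrefix (suc t) (x ∷ xs) = 0# ∷ zeroPrefix t xs

  zeroPrefix-idem : ∀ {m} t (x : Vect F m) → zeroPrefix t (zeroPrefix t x) ≡ zeroPrefix t x
  zeroPrefix-idem zero    x        = refl
  zeroPrefix-idem (suc t) []       = refl
  zeroPrefix-idem (suc t) (x ∷ xs) = cong (0# ∷_) (zeroPrefix-idem t xs)

  zeroPrefix-· : ∀ {m} t (r x : Vect F m) → zeroPrefix t r · x ≡ r · zeroPrefix t x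
  zeroPrefix-· zero    r        x        = refl
  zeroPrefix-· (suc t) []       []       = refl
  zeroPrefix-· (suc t) (r ∷ rs) (x ∷ xs) = cong₂ _+ᶠ_ (trans (zeroˡ x) (sym (zeroʳ r))) (zeroPrefix-· t rs xs)

  zeroPrefix-fixed : ∀ {m} t (r : Vect F m) → (∀ j → toℕ j < t → lookup r j ≡ 0#) → zeroPrefix t r ≡ r
  zeroPrefix-fixed zero    r        _        = refl
  zeroPrefix-fixed (suc t) []       _        = refl
  zeroPrefix-fixed (suc t) (x ∷ xs) prefix≡0 =
    cong₂ _∷_ (sym (prefix≡0 fzero (s≤s z≤n))) (zeroPrefix-fixed t xs (λ j j<t → prefix≡0 (fsuc j) (s≤s j<t)))

  isZeroPrefixed : ∀ {m} → ℕ → Vect F m → Bool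
  isZeroPrefixed t x = does (x ≟ᵛ zeroPrefix t x)

  count-isZeroPrefixed : ∀ m t → t ≤ m → count (isZeroPrefixed t) (allVects F m) ≡ q ^ (m ∸ t)
  count-isZeroPrefixed m zero _ =
    trans (count-all _ (allVects F m) (λ x → dec-true (x ≟ᵛ x) refl)) (length-allVecsOf elements m)
  count-isZeroPrefixed (suc m) (suc t) (s≤s t≤m) = begin
    count (isZeroPrefixed (suc t)) (allVects F (suc m))  ≡⟨ count-allVecsOf-suc _ elements ⟩
    sum (map (λ a → count (λ v → isZeroPrefixed (suc t) (a ∷ v)) (allVects F m)) elements)
      ≡⟨ sum-map-indicator _ (λ a → does (a ≟ 0#)) K elements heads ⟩
    count (λ a → does (a ≟ 0#)) elements * K
      ≡⟨ cong (_* K) (count-only-0# _ (dec-true (0# ≟ 0#) refl) (λ a → dec-true⁻ (a ≟ 0#))) ⟩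
    1 * K                                     ≡⟨ ℕₚ.*-identityˡ K ⟩
    K                                         ≡⟨ count-isZeroPrefixed m t t≤m ⟩
    q ^ (m ∸ t)                               ∎
    where
    open ≡-Reasoning
    K = count (isZeroPrefixed t) (allVects F m)
    heads : ∀ a → count (λ v → isZeroPrefixed (suc t) (a ∷ v)) (allVects F m) ≡ (if does (a ≟ 0#) then K else 0)
    heads a with does (a ≟ 0#)
    ... | true  = refl
    ... | false = count-none _ (allVects F m) (λ _ ())

  -- A matrix whose first t columns vanish maps every x to the same vector as zeroPrefix t x,
  -- so its column space is the image of a set of q ^ (m ∸ t) vectors.
  rk≤m∸t : ∀ {n m} t → t ≤ m → (D : Mat F n m) →
           (∀ i j → toℕ j < t → lookup (lookup D i) j ≡ 0#) → rk F D ≤ m ∸ t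
  rk≤m∸t {n} {m} t t≤m D prefix≡0 = ^-cancelʳ-≤ 1<q (begin
    q ^ rk F D                                              ≡⟨ count≡q^dimOf-vectors (colsp-isSubmodule D) ⟨
    count (inColsp F D) (allVects F n)
      ≤⟨ unique-⊆⇒length-≤ (filterᵇ-unique (inColsp F D) (EnumModule.enum-unique (Fⁿ n))) colsp⊆image ⟩
    length (map (mulVec F D) (filterᵇ (isZeroPrefixed t) (allVects F m)))
      ≡⟨ Listₚ.length-map (mulVec F D) (filterᵇ (isZeroPrefixed t) (allVects F m)) ⟩
    count (isZeroPrefixed t) (allVects F m)                 ≡⟨ count-isZeroPrefixed m t t≤m ⟩
    q ^ (m ∸ t)                                             ∎)
    where
    open ℕₚ.≤-Reasoning
    Dx≡Dzx : ∀ {n} (D : Mat F n m) → (∀ i j → toℕ j < t → lookup (lookup D i) j ≡ 0#) →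
             ∀ x → mulVec F D x ≡ mulVec F D (zeroPrefix t x)
    Dx≡Dzx []      _        x = refl
    Dx≡Dzx (r ∷ D) prefix≡0 x = cong₂ _∷_
      (trans (cong (_· x) (sym (zeroPrefix-fixed t r (prefix≡0 fzero)))) (zeroPrefix-· t r x))
      (Dx≡Dzx D (λ i → prefix≡0 (fsuc i)) x)
    colsp⊆image : ∀ {v} → v ∈ filterᵇ (inColsp F D) (allVects F n) →
                  v ∈ map (mulVec F D) (filterᵇ (isZeroPrefixed t) (allVects F m))
    colsp⊆image v∈ with any≡true⁻ _ (allVects F m) (proj₂ (∈-filterᵇ⁻ (inColsp F D) {xs = allVects F n} v∈))
    ... | x , _ , Dx≡v = subst (_∈ map (mulVec F D) (filterᵇ (isZeroPrefixed t) (allVects F m)))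
          (trans (sym (Dx≡Dzx D prefix≡0 x)) (dec-true⁻ (_ ≟ᵛ _) Dx≡v))
          (∈-map⁺ (mulVec F D) (∈-filterᵇ⁺ (isZeroPrefixed t) (EnumModule.∈-enum (Fⁿ m) (zeroPrefix t x))
            (dec-true (_ ≟ᵛ _) (sym (zeroPrefix-idem t x)))))

  -- Shortened codes

  col-zero : ∀ {n m} (j : Fin m) → col F (zeroMat F n m) j ≡ replicate n 0#
  col-zero {zero}  j = refl
  col-zero {suc n} j = cong₂ _∷_ (Vecₚ.lookup-replicate j 0#) (col-zero j)

  col-+ : ∀ {n m} (M M′ : Mat F n m) j →
          col F (zipWith (zipWith _+ᶠ_) M M′) j ≡ zipWith _+ᶠ_ (col F M j) (col F M′ j)
  col-+ []      []        j = refl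
  col-+ (r ∷ M) (r′ ∷ M′) j = cong₂ _∷_ (Vecₚ.lookup-zipWith _+ᶠ_ j r r′) (col-+ M M′ j)

  col-* : ∀ {n m} c (M : Mat F n m) j → col F (Vec.map (Vec.map (c *ᶠ_)) M) j ≡ Vec.map (c *ᶠ_) (col F M j)
  col-* c []      j = refl
  col-* c (r ∷ M) j = cong₂ _∷_ (Vecₚ.lookup-map j (c *ᶠ_) r) (col-* c M j)

  lookup-col : ∀ {n m} (M : Mat F n m) i j → lookup (col F M j) i ≡ lookup (lookup M i) j
  lookup-col M i j = Vecₚ.lookup-map i (λ r → lookup r j) M

  shortened-isSubmodule : ∀ {n m} (C : Code F n m) (X : Subspace (VecSpace F n)) →
                          IsSubmodule (Fⁿˣᵐ n m) (inShortened F C X)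
  shortened-isSubmodule {n} {m} C X = record
    { 0ᴹ∈      = ∧≡true⁺ (mem-zero C) (columns⊥ λ j →
        subst (λ w → inPerp F X w ≡ true) (sym (col-zero j)) X⊥.0ᴹ∈)
    ; +-closed = λ {M} {M′} M∈ M′∈ →
        let M∈C , M⊥ = ∧≡true⁻ M∈ ; M′∈C , M′⊥ = ∧≡true⁻ M′∈ in
        ∧≡true⁺ (mem-add C M M′ M∈C M′∈C) (columns⊥ λ j →
          subst (λ w → inPerp F X w ≡ true) (sym (col-+ M M′ j)) (X⊥.+-closed (column⊥ M⊥ j) (column⊥ M′⊥ j)))
    ; *-closed = λ c {M} M∈ →
        let M∈C , M⊥ = ∧≡true⁻ M∈ in
        ∧≡true⁺ (mem-smul C c M M∈C) (columns⊥ λ j → subst (λ w → inPerp F X w ≡ true) (sym (col-* c M j))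
          (X⊥.*-closed c (column⊥ M⊥ j)))
    }
    where
    module X⊥ = IsSubmodule (orth-isSubmodule (mem X))
    column⊥ : ∀ {M} → all (λ j → inPerp F X (col F M j)) (allFin m) ≡ true → ∀ j → inPerp F X (col F M j) ≡ true
    column⊥ M⊥ j = all≡true⁻ _ (allFin m) M⊥ (∈-allFin j)
    columns⊥ : ∀ {M} → (∀ j → inPerp F X (col F M j) ≡ true) → all (λ j → inPerp F X (col F M j)) (allFin m) ≡ true
    columns⊥ M⊥ = all≡true⁺ _ (allFin m) (λ {j} _ → M⊥ j)

  firstColumns : ∀ {n m t} → t ≤ m → Mat F n m → Vec (Vect F n) t
  firstColumns t≤m M = tabulate (λ i → col F M (inject≤ i t≤m))

  firstColumns-≡ : ∀ {n m t} (t≤m : t ≤ m) {M M′ : Mat F n m} → firstColumns t≤m M ≡ firstColumns t≤m M′ →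
                   ∀ i j → toℕ j < t → lookup (lookup M i) j ≡ lookup (lookup M′ i) j
  firstColumns-≡ t≤m {M} {M′} eq i j j<t = begin
    lookup (lookup M i) j   ≡⟨ lookup-col M i j ⟨
    lookup (col F M j) i    ≡⟨ cong (λ c → lookup c i) colM≡colM′ ⟩
    lookup (col F M′ j) i   ≡⟨ lookup-col M′ i j ⟩
    lookup (lookup M′ i) j  ∎
    where
    open ≡-Reasoning
    k = fromℕ< j<t
    k≡j : inject≤ k t≤m ≡ j
    k≡j = Finₚ.toℕ-injective (trans (Finₚ.toℕ-inject≤ k t≤m) (Finₚ.toℕ-fromℕ< j<t))
    colM≡colM′ : col F M j ≡ col F M′ j
    colM≡colM′ = subst (λ j′ → col F M j′ ≡ col F M′ j′) k≡j (begin
      col F M (inject≤ k t≤m)         ≡⟨ Vecₚ.lookup∘tabulate _ k ⟨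
      lookup (firstColumns t≤m M) k   ≡⟨ cong (λ cs → lookup cs k) eq ⟩
      lookup (firstColumns t≤m M′) k  ≡⟨ Vecₚ.lookup∘tabulate _ k ⟩
      col F M′ (inject≤ k t≤m)        ∎)

  dimShortened : ∀ {n m} → Code F n m → Subspace (VecSpace F n) → ℕ
  dimShortened {n} {m} C X = dimOf (MatSpace F n m) (inShortened F C X)

  module _ {n m t} (C : Code F n m) (t≤m : t ≤ m)
           (rank-large : ∀ M → mem C M ≡ true → M ≢ zeroMat F n m → m ∸ t < rk F M) where

    private
      module Mat = EnumModule (Fⁿˣᵐ n m)

    -- M - M′ lies in C and vanishes on the first t columns, so its rank is at most m ∸ t.
    firstColumns-injective : ∀ {M M′} → mem C M ≡ true → mem C M′ ≡ true →
                             firstColumns t≤m M ≡ firstColumns t≤m M′ → M ≡ M′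
    firstColumns-injective {M} {M′} M∈ M′∈ eq = begin
      M                                  ≡⟨ Mat.+ᴹ-identityʳ M ⟨
      M Mat.+ᴹ Mat.0ᴹ                    ≡⟨ cong (M Mat.+ᴹ_) (Mat.-1*ᴹ-inverseˡ M′) ⟨
      M Mat.+ᴹ (D′ Mat.+ᴹ M′)            ≡⟨ Mat.+ᴹ-assoc M D′ M′ ⟨
      D Mat.+ᴹ M′                        ≡⟨ cong (Mat._+ᴹ M′) D≡0 ⟩
      Mat.0ᴹ Mat.+ᴹ M′                   ≡⟨ Mat.+ᴹ-identityˡ M′ ⟩
      M′                                 ∎
      where
      open ≡-Reasoning
      D′ = (- 1#) Mat.*ᴹ M′
      D = M Mat.+ᴹ D′
      D∈C : mem C D ≡ true
      D∈C = mem-add C M D′ M∈ (mem-smul C (- 1#) M′ M′∈)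
      D-prefix≡0 : ∀ i j → toℕ j < t → lookup (lookup D i) j ≡ 0#
      D-prefix≡0 i j j<t = begin
        lookup (lookup D i) j                                          ≡⟨ cong (λ r → lookup r j) row-i ⟩
        lookup (zipWith _+ᶠ_ (lookup M i) (Vec.map ((- 1#) *ᶠ_) (lookup M′ i))) j
          ≡⟨ Vecₚ.lookup-zipWith _+ᶠ_ j (lookup M i) _ ⟩
        lookup (lookup M i) j +ᶠ lookup (Vec.map ((- 1#) *ᶠ_) (lookup M′ i)) j
          ≡⟨ cong (lookup (lookup M i) j +ᶠ_) (Vecₚ.lookup-map j _ (lookup M′ i)) ⟩
        lookup (lookup M i) j +ᶠ (- 1#) *ᶠ lookup (lookup M′ i) j
          ≡⟨ cong (λ x → x +ᶠ (- 1#) *ᶠ lookup (lookup M′ i) j) (firstColumns-≡ t≤m eq i j j<t) ⟩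
        lookup (lookup M′ i) j +ᶠ (- 1#) *ᶠ lookup (lookup M′ i) j    ≡⟨ x+-1*x≡0 _ ⟩
        0#                                                             ∎
        where
        row-i : lookup D i ≡ zipWith _+ᶠ_ (lookup M i) (Vec.map ((- 1#) *ᶠ_) (lookup M′ i))
        row-i = trans (Vecₚ.lookup-zipWith _ i M _) (cong (zipWith _+ᶠ_ (lookup M i)) (Vecₚ.lookup-map i _ M′))
      D≡0 : D ≡ Mat.0ᴹ
      D≡0 with Vecₚ.≡-dec _≟ᵛ_ D Mat.0ᴹ
      ... | yes D≡0 = D≡0
      ... | no  D≢0 = ⊥-elim (ℕₚ.<⇒≱ (rank-large D D∈C D≢0) (rk≤m∸t t t≤m D D-prefix≡0))

    count-shortened≤ : ∀ X → count (inShortened F C X) (allMats F n m) ≤ count (inPerp F X) (allVects F n) ^ t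
    count-shortened≤ X = begin
      count (inShortened F C X) (allMats F n m)                       ≤⟨ count-≤-injection _ (allᵛ (inPerp F X))
                                                                           (firstColumns t≤m) Mat.enum-unique
                                                                           (EnumModule.∈-enum (Vecᴹ (Fⁿ n) t))
                                                                           columns⊥ injective ⟩
      count (allᵛ (inPerp F X)) (allVecsOf (allVects F n) t)          ≡⟨ count-allᵛ (inPerp F X) (allVects F n) t ⟩
      count (inPerp F X) (allVects F n) ^ t                           ∎
      where
      open ℕₚ.≤-Reasoning
      columns⊥ : ∀ M → inShortened F C X M ≡ true → allᵛ (inPerp F X) (firstColumns t≤m M) ≡ true
      columns⊥ M M∈ = allᵛ-tabulate _ _ λ i →
        all≡true⁻ _ (allFin m) (proj₂ (∧≡true⁻ M∈)) (∈-allFin (inject≤ i t≤m))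
      injective : ∀ M M′ → inShortened F C X M ≡ true → inShortened F C X M′ ≡ true →
                  firstColumns t≤m M ≡ firstColumns t≤m M′ → M ≡ M′
      injective M M′ M∈ M′∈ = firstColumns-injective (proj₁ (∧≡true⁻ M∈)) (proj₁ (∧≡true⁻ M′∈))

    dimShortened≤ : ∀ X → dimShortened C X ≤ dimOf (VecSpace F n) (inPerp F X) * t
    dimShortened≤ X = ^-cancelʳ-≤ 1<q (begin
      q ^ dimShortened C X                         ≡⟨ count≡q^dimOf-matrices (shortened-isSubmodule C X) ⟨
      count (inShortened F C X) (allMats F n m)    ≤⟨ count-shortened≤ X ⟩
      count (inPerp F X) (allVects F n) ^ t        ≡⟨ cong (_^ t) (count≡q^dimOf-vectors (orth-isSubmodule (mem X))) ⟩
      (q ^ dimOf (VecSpace F n) (inPerp F X)) ^ t  ≡⟨ ℕₚ.^-*-assoc q (dimOf (VecSpace F n) (inPerp F X)) t ⟩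
      q ^ (dimOf (VecSpace F n) (inPerp F X) * t)  ∎)
      where open ℕₚ.≤-Reasoning

  -- MRD codes with at least as many rows as columns

  module MRD {n m} (C : Code F (suc n) m) (m≤n : m ≤ suc n) {d}
             (d≤rk : ∀ M → mem C M ≡ true → M ≢ zeroMat F (suc n) m → d ≤ rk F M) (mrd : IsMRD F C d) where

    t : ℕ
    t = suc (m ∸ d)

    dim≡ : dim C ≡ suc n * t
    dim≡ = begin
      dim C                                 ≡⟨ mrd ⟩
      (suc n ℕ.⊔ m) * ((suc n ℕ.⊓ m) ∸ d + 1)
        ≡⟨ cong₂ (λ a b → a * (b ∸ d + 1)) (ℕₚ.m≥n⇒m⊔n≡m m≤n) (ℕₚ.m≥n⇒m⊓n≡n m≤n) ⟩
      suc n * (m ∸ d + 1)                   ≡⟨ cong (suc n *_) (ℕₚ.+-comm (m ∸ d) 1) ⟩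
      suc n * t                             ∎
      where open ≡-Reasoning

    t≤m : t ≤ m
    t≤m = ℕₚ.*-cancelˡ-≤ (suc n) (subst (_≤ suc n * m) dim≡ (dim≤n*m C))

    m∸t<d : m ∸ t < d
    m∸t<d = m∸[1+m∸d]<d m d t≤m

    rank-large : ∀ M → mem C M ≡ true → M ≢ zeroMat F (suc n) m → m ∸ t < rk F M
    rank-large M M∈ M≢0 = ℕₚ.<-≤-trans m∸t<d (d≤rk M M∈ M≢0)

    ρ-numerator : Subspace (VecSpace F (suc n)) → ℕ
    ρ-numerator X = dim C ∸ dimShortened C X

    module _ (X : Subspace (VecSpace F (suc n))) where

      private
        u v s : ℕ
        u = dim X
        v = dimOf (VecSpace F (suc n)) (inPerp F X)
        s = dimShortened C X

        s≤vt : s ≤ v * t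
        s≤vt = dimShortened≤ C t≤m rank-large X

        dim≡ut+vt : dim C ≡ u * t + v * t
        dim≡ut+vt = trans dim≡ (trans (cong (_* t) (sym (dim+dim-perp X))) (ℕₚ.*-distribʳ-+ t u v))

      dimShortened≤dim : s ≤ dim C
      dimShortened≤dim = subst (s ≤_) (sym dim≡ut+vt) (ℕₚ.≤-trans s≤vt (ℕₚ.m≤n+m (v * t) (u * t)))

      dim≤ρ-numerator : u ≤ ρ-numerator X
      dim≤ρ-numerator = ℕₚ.≤-trans (ℕₚ.m≤m*n u t)
        (ℕₚ.m+n≤o⇒m≤o∸n (u * t) (subst (u * t + s ≤_) (sym dim≡ut+vt) (ℕₚ.+-monoʳ-≤ (u * t) s≤vt)))

      ρ≡ : ρ[ F ] C X ≡ divℕ (+ ρ-numerator X) m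
      ρ≡ = cong (λ z → divℕ z m) (trans (ℤₚ.m-n≡m⊖n (dim C) s) (ℤₚ.⊖-≥ dimShortened≤dim))

toℚᵘ-divℕ : ∀ i d → toℚᵘ (divℕ i (suc d)) ℚᵘ.≃ mkℚᵘ i d
toℚᵘ-divℕ i d = ℚₚ.toℚᵘ-fromℚᵘ (mkℚᵘ i d)

divℕ-mono-≤ : ∀ {u v} d → u ≤ v → divℕ (+ u) (suc d) ℚ.≤ divℕ (+ v) (suc d)
divℕ-mono-≤ {u} {v} d u≤v = ℚₚ.toℚᵘ-cancel-≤
  (ℚᵘₚ.≤-respʳ-≃ (ℚᵘₚ.≃-sym (toℚᵘ-divℕ (+ v) d))
    (ℚᵘₚ.≤-respˡ-≃ (ℚᵘₚ.≃-sym (toℚᵘ-divℕ (+ u) d))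
      (*≤* (ℤₚ.*-monoʳ-≤-nonNeg (+ suc d) (ℤ.+≤+ u≤v)))))

*-divℕ-cancel : ∀ i d → divℕ (+ suc d) 1 ℚ.* divℕ i (suc d) ≡ divℕ i 1
*-divℕ-cancel i d = ℚₚ.toℚᵘ-injective (begin
  toℚᵘ (divℕ (+ suc d) 1 ℚ.* divℕ i (suc d))          ≈⟨ ℚₚ.toℚᵘ-homo-* (divℕ (+ suc d) 1) _ ⟩
  toℚᵘ (divℕ (+ suc d) 1) ℚᵘ.* toℚᵘ (divℕ i (suc d))  ≈⟨ ℚᵘₚ.*-cong (toℚᵘ-divℕ (+ suc d) 0) (toℚᵘ-divℕ i d) ⟩
  mkℚᵘ (+ suc d) 0 ℚᵘ.* mkℚᵘ i d                      ≈⟨ *≡* (cancel (+ suc d) i) ⟩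
  mkℚᵘ i 0                                            ≈⟨ toℚᵘ-divℕ i 0 ⟨
  toℚᵘ (divℕ i 1)                                     ∎)
  where
  open ℚᵘₚ.≃-Reasoning
  cancel : ∀ D i → (D ℤ.* i) ℤ.* + 1 ≡ i ℤ.* (+ 1 ℤ.* D)
  cancel = solve-∀

divℕ<1⇒< : ∀ a b′ → divℕ (+ a) (suc b′) <ℚ 1ℚ → a < suc b′
divℕ<1⇒< a b′ a/b<1
  with ℚᵘₚ.<-respʳ-≃ (toℚᵘ-divℕ (+ 1) 0) (ℚᵘₚ.<-respˡ-≃ (toℚᵘ-divℕ (+ a) b′) (ℚₚ.toℚᵘ-mono-< a/b<1))
... | *<* a*1<1*b = subst₂ _<_ (ℕₚ.*-identityʳ a) (ℕₚ.*-identityˡ (suc b′))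
  (ℤₚ.drop‿+<+ (subst₂ ℤ._<_ (sym (ℤₚ.pos-* a 1)) (sym (ℤₚ.pos-* 1 (suc b′))) a*1<1*b))

module _ (a c b′ m′ e₁ e₂ : ℕ) (b≡a+c : suc b′ ≡ a + c) where

  private
    λ′ = divℕ (+ a) (suc b′)
    λᵘ = mkℚᵘ (+ a) b′

  -- In ℚᵘ the cross-multiplied equation is a ring identity once b is replaced by a + c.
  mix-divℕ : (1ℚ ℚ.- λ′) ℚ.* divℕ (+ e₁) (suc m′) ℚ.+ λ′ ℚ.* divℕ (+ e₂) (suc m′)
             ≡ divℕ (+ (c * e₁ + a * e₂)) (suc b′ * suc m′)
  mix-divℕ = ℚₚ.toℚᵘ-injective (begin
    toℚᵘ ((1ℚ ℚ.- λ′) ℚ.* divℕ (+ e₁) (suc m′) ℚ.+ λ′ ℚ.* divℕ (+ e₂) (suc m′))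
      ≈⟨ ℚₚ.toℚᵘ-homo-+ ((1ℚ ℚ.- λ′) ℚ.* divℕ (+ e₁) (suc m′)) (λ′ ℚ.* divℕ (+ e₂) (suc m′)) ⟩
    toℚᵘ ((1ℚ ℚ.- λ′) ℚ.* divℕ (+ e₁) (suc m′)) ℚᵘ.+ toℚᵘ (λ′ ℚ.* divℕ (+ e₂) (suc m′))
      ≈⟨ ℚᵘₚ.+-cong
           (ℚᵘₚ.≃-trans (ℚₚ.toℚᵘ-homo-* (1ℚ ℚ.- λ′) _) (ℚᵘₚ.*-cong 1-λ≃ (toℚᵘ-divℕ (+ e₁) m′)))
           (ℚᵘₚ.≃-trans (ℚₚ.toℚᵘ-homo-* λ′ _) (ℚᵘₚ.*-cong (toℚᵘ-divℕ (+ a) b′) (toℚᵘ-divℕ (+ e₂) m′))) ⟩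
    (mkℚᵘ (+ 1) 0 ℚᵘ.- λᵘ) ℚᵘ.* mkℚᵘ (+ e₁) m′ ℚᵘ.+ λᵘ ℚᵘ.* mkℚᵘ (+ e₂) m′
      ≈⟨ *≡* (cross B≡A+C) ⟩
    mkℚᵘ (+ (c * e₁ + a * e₂)) (m′ + b′ * suc m′)
      ≈⟨ toℚᵘ-divℕ (+ (c * e₁ + a * e₂)) (m′ + b′ * suc m′) ⟨
    toℚᵘ (divℕ (+ (c * e₁ + a * e₂)) (suc b′ * suc m′)) ∎)
    where
    open ℚᵘₚ.≃-Reasoning
    1-λ≃ : toℚᵘ (1ℚ ℚ.- λ′) ℚᵘ.≃ mkℚᵘ (+ 1) 0 ℚᵘ.- λᵘ
    1-λ≃ = ℚᵘₚ.≃-trans (ℚₚ.toℚᵘ-homo-+ 1ℚ (ℚ.- λ′))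
             (ℚᵘₚ.+-cong (ℚᵘₚ.≃-refl {toℚᵘ 1ℚ})
               (ℚᵘₚ.≃-trans (ℚₚ.toℚᵘ-homo‿- λ′) (ℚᵘₚ.-‿cong (toℚᵘ-divℕ (+ a) b′))))
    identity : ∀ A C E₁ E₂ M →
      ((((+ 1) ℤ.* (A ℤ.+ C) ℤ.+ (ℤ.- A) ℤ.* (+ 1)) ℤ.* E₁) ℤ.* ((A ℤ.+ C) ℤ.* M)
        ℤ.+ (A ℤ.* E₂) ℤ.* (((+ 1) ℤ.* (A ℤ.+ C)) ℤ.* M)) ℤ.* ((A ℤ.+ C) ℤ.* M)
      ≡ (C ℤ.* E₁ ℤ.+ A ℤ.* E₂) ℤ.* ((((+ 1) ℤ.* (A ℤ.+ C)) ℤ.* M) ℤ.* ((A ℤ.+ C) ℤ.* M))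
    identity = solve-∀
    B≡A+C : + suc b′ ≡ + a ℤ.+ + c
    B≡A+C = trans (cong +_ b≡a+c) (ℤₚ.pos-+ a c)
    N≡ : + (c * e₁ + a * e₂) ≡ + c ℤ.* + e₁ ℤ.+ + a ℤ.* + e₂
    N≡ = trans (ℤₚ.pos-+ (c * e₁) (a * e₂)) (cong₂ ℤ._+_ (ℤₚ.pos-* c e₁) (ℤₚ.pos-* a e₂))
    cross : ∀ {B} → B ≡ + a ℤ.+ + c →
            ((((+ 1) ℤ.* B ℤ.+ (ℤ.- + a) ℤ.* (+ 1)) ℤ.* + e₁) ℤ.* (B ℤ.* + suc m′)
              ℤ.+ (+ a ℤ.* + e₂) ℤ.* (((+ 1) ℤ.* B) ℤ.* + suc m′)) ℤ.* (B ℤ.* + suc m′)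
            ≡ + (c * e₁ + a * e₂) ℤ.* ((((+ 1) ℤ.* B) ℤ.* + suc m′) ℤ.* (B ℤ.* + suc m′))
    cross refl = trans (identity (+ a) (+ c) (+ e₁) (+ e₂) (+ suc m′)) (cong (ℤ._* _) (sym N≡))

theorem8p8 : (F : FiniteField) (n : ℕ) → 2 ≤ n →
  (C₁ C₂ : Code F n (n ∸ 1)) (k₁ k₂ d₁ d₂ : ℕ) →
  dim C₁ ≡ k₁ → IsMinDist F C₁ d₁ → IsMRD F C₁ d₁ →
  dim C₂ ≡ k₂ → IsMinDist F C₂ d₂ → IsMRD F C₂ d₂ →
  1 < k₁ → k₁ < k₂ → n ≤ k₁ + k₂ →
  (a b : ℕ) → gcd a b ≡ 1 →
  0ℚ <ℚ divℕ (+ a) b → divℕ (+ a) b <ℚ 1ℚ →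
  IsDenominator F (mix F (divℕ (+ a) b) (ρ[ F ] C₁) (ρ[ F ] C₂)) (b * (n ∸ 1))
  × (∀ I → IsIndep F (mix F (divℕ (+ a) b) (ρ[ F ] C₁) (ρ[ F ] C₂)) (b * (n ∸ 1)) I)
-- divℕ _ 0 is 0ℚ, so 0 < λ excludes b = 0.
theorem8p8 F (suc (suc n)) (s≤s (s≤s _)) C₁ C₂ _ _ _ _ _ _ _ _ _ _ _ _ _ a zero _ 0<λ _ =
  ⊥-elim (ℚₚ.<-irrefl refl 0<λ)
theorem8p8 F (suc (suc n)) (s≤s (s≤s _)) C₁ C₂ _ _ _ _ _ md₁ mrd₁ _ md₂ mrd₂ _ _ _ a (suc b′) _ _ λ<1 =
  (s≤s z≤n , λ X → N X , denominator X) , λ _ J _ → independent J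
  where
  λ′ = divℕ (+ a) (suc b′)
  c = suc b′ ∸ a
  b≡a+c : suc b′ ≡ a + c
  b≡a+c = sym (ℕₚ.m+[n∸m]≡n (ℕₚ.<⇒≤ (divℕ<1⇒< a b′ λ<1)))
  module M₁ = MRD F C₁ (ℕₚ.n≤1+n (suc n)) (proj₂ md₁) mrd₁
  module M₂ = MRD F C₂ (ℕₚ.n≤1+n (suc n)) (proj₂ md₂) mrd₂
  N : Subspace (VecSpace F (suc (suc n))) → ℕ
  N X = c * M₁.ρ-numerator X + a * M₂.ρ-numerator X
  mix≡N/μ : ∀ X → mix F λ′ (ρ[ F ] C₁) (ρ[ F ] C₂) X ≡ divℕ (+ N X) (suc b′ * suc n)
  mix≡N/μ X = trans (cong₂ (λ r₁ r₂ → (1ℚ ℚ.- λ′) ℚ.* r₁ ℚ.+ λ′ ℚ.* r₂) (M₁.ρ≡ X) (M₂.ρ≡ X))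
                    (mix-divℕ a c b′ n _ _ b≡a+c)
  denominator : ∀ X → divℕ (+ (suc b′ * suc n)) 1 ℚ.* mix F λ′ (ρ[ F ] C₁) (ρ[ F ] C₂) X ≡ divℕ (+ N X) 1
  denominator X = trans (cong (divℕ (+ (suc b′ * suc n)) 1 ℚ.*_) (mix≡N/μ X))
                        (*-divℕ-cancel (+ N X) (n + b′ * suc n))
  independent : ∀ J → divℕ (+ dim J) (suc b′ * suc n) ℚ.≤ mix F λ′ (ρ[ F ] C₁) (ρ[ F ] C₂) J
  independent J = subst (divℕ (+ dim J) (suc b′ * suc n) ℚ.≤_) (sym (mix≡N/μ J))
    (divℕ-mono-≤ _ (≤-positive-combination a c (subst (0 <_) b≡a+c (s≤s z≤n))
      (M₁.dim≤ρ-numerator J) (M₂.dim≤ρ-numerator J)))
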